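{- For every integer $n\ge 1$, $$ (1-q^n)GF_n(q)=-(q^{2n-2}+q^{3n-3})GF_{n-2}(q)+(q^{2n-2}+q^{3n-4}+q^{3n-3})GF_{n-3}(q)-q^{3n-4}GF_{n-4}(q), $$ with the convention $GF_m(q)=0$ for $m<0$.
   Context: Partitions are written with parts in increasing order. A partition $\lambda$ is neighborly if every value occurs as a part at most twice and for every part $\lambda_i$ there is a part $\lambda_j$ with $j\ne i$ and $|\lambda_i-\lambda_j|\le 1$ (the empty partition is neighborly). Write $\lambda=(\mu_1,\mu_2)$ where $\mu_1$ is the set of distinct part values and $\mu_2\subseteq\mu_1$ the set of values occurring twice. The graph $G_\lambda$ has one vertex $v$ for each $v\in\mu_1$ and one additional vertex $v'$ for each $v\in\mu_2$; its edges are $\{v,v+1\}$ whenever $v,v+1\in\mu_1$, and $\{v,v'\}$ for $v\in\mu_2$. Each connected component $c$ of $G_\lambda$ has backbone vertices forming a maximal run $\{k,\dots,n\}$ of consecutive integers in $\mu_1$; let $a_1<\dots<a_s$ be the elements of $\mu_2$ in this run. If $s\ge1$, $SIG(c)=\{a_1-k+1, a_2-a_1+2,\dots,a_s-a_{s-1}+2, n-a_s+1\}$ (multiset); if $s=0$, $SIG(c)=\{n-k\}$. $SIG(G_\lambda)$ is the multiset union over components. A neighborly $\lambda$ is admissible if $SIG(G_\lambda)$ contains no multiple of $3$. For admissible $\lambda$, $\operatorname{sign}(\lambda)=(-1)^{t+s}$, where $t$ is the number of elements of $SIG(G_\lambda)$ (with multiplicity) congruent to $1\bmod 3$ and $s$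 is the number of parts of $\mu_2$. For $n\ge0$, $GF_n(q)=\sum \operatorname{sign}(\lambda)q^{|\lambda|}$, summed over admissible neighborly partitions $\lambda$ with exactly $n$ parts (counted with multiplicity); in particular $GF_0(q)=1$. -}

module Defs where

open import Data.Nat using (ℕ; zero; suc; _+_; _*_; _∸_; _≡ᵇ_; _≤ᵇ_; ∣_-_∣; _%_)
open import Data.Bool using (Bool; true; false; _∧_; not; if_then_else_)
open import Data.Product using (_×_; _,_)
open import Data.Fin using (Fin; toℕ)
open import Data.List using (List; []; _∷_; map; concatMap; length; upTo; allFin; filterᵇ; lookup; foldr)
open import Data.Bool.ListAction using (all; any)
open import Data.Nat.ListAction using (sum)
open import Data.Integer as ℤ using (ℤ; +_; -[1+_])

-- Partitions are lists of positive parts, written in increasing order.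

sortedᵇ : List ℕ → Bool
sortedᵇ [] = true
sortedᵇ (x ∷ []) = true
sortedᵇ (x ∷ y ∷ xs) = (x ≤ᵇ y) ∧ sortedᵇ (y ∷ xs)

count : ℕ → List ℕ → ℕ
count v [] = 0
count v (y ∷ ys) = if v ≡ᵇ y then suc (count v ys) else count v ys

nub : List ℕ → List ℕ
nub [] = []
nub (x ∷ xs) = x ∷ filterᵇ (λ y → not (x ≡ᵇ y)) (nub xs)

μ₁ : List ℕ → List ℕ
μ₁ λ' = nub λ'

μ₂ : List ℕ → List ℕ
μ₂ λ' = filterᵇ (λ v → 2 ≤ᵇ count v λ') (μ₁ λ')

neighborlyᵇ : List ℕ → Bool
neighborlyᵇ λ' =
  all (λ v → count v λ' ≤ᵇ 2) λ' ∧
  all (λ i → any (λ j → not (toℕ i ≡ᵇ toℕ j) ∧ (∣ lookup λ' i - lookup λ' j ∣ ≤ᵇ 1))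
                 (allFin (length λ')))
      (allFin (length λ'))

-- Connected components of G_λ: each is determined by a maximal run
-- {k,…,n} of consecutive integers in μ₁ (plus the primed vertices v'
-- for v ∈ μ₂ in the run).  runs returns the pairs (k , n).

addToRuns : ℕ → List (ℕ × ℕ) → List (ℕ × ℕ)
addToRuns x [] = (x , x) ∷ []
addToRuns x ((k , n) ∷ rs) =
  if suc x ≡ᵇ k then (x , n) ∷ rs else (x , x) ∷ (k , n) ∷ rs

-- input: strictly increasing list
runs : List ℕ → List (ℕ × ℕ)
runs [] = []
runs (x ∷ xs) = addToRuns x (runs xs)

-- SIG of a component with backbone {k..n} and a₁<…<a_s the μ₂-elements in it
sigTail : ℕ → ℕ → List ℕ → List ℕ
sigTail n prev [] = (n ∸ prev + 1) ∷ []
sigTail n prev (b ∷ bs) = (b ∸ prev + 2) ∷ sigTail n b bs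

sigComp : ℕ → ℕ → List ℕ → List ℕ
sigComp k n [] = (n ∸ k) ∷ []
sigComp k n (a ∷ as) = (a ∸ k + 1) ∷ sigTail n a as

SIG : List ℕ → List ℕ
SIG λ' = concatMap comp (runs (μ₁ λ'))
  where
  comp : ℕ × ℕ → List ℕ
  comp (k , n) = sigComp k n (filterᵇ (λ a → (k ≤ᵇ a) ∧ (a ≤ᵇ n)) (μ₂ λ'))

admissibleᵇ : List ℕ → Bool
admissibleᵇ λ' = neighborlyᵇ λ' ∧ all (λ x → not (x % 3 ≡ᵇ 0)) (SIG λ')

countᵇ : (ℕ → Bool) → List ℕ → ℕ
countᵇ p xs = length (filterᵇ p xs)

negOnePow : ℕ → ℤ
negOnePow zero = + 1
negOnePow (suc e) = ℤ.- negOnePow e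

sign : List ℕ → ℤ
sign λ' = negOnePow (countᵇ (λ x → x % 3 ≡ᵇ 1) (SIG λ') + length (μ₂ λ'))

listsOf : ℕ → List ℕ → List (List ℕ)
listsOf zero L = [] ∷ []
listsOf (suc n) L = concatMap (λ x → map (x ∷_) (listsOf n L)) L

sumℤ : List ℤ → ℤ
sumℤ = foldr ℤ._+_ (+ 0)

Series : Set
Series = ℕ → ℤ

-- coefficient of q^m in GF_n(q): sum of sign(λ) over admissible neighborly
-- partitions λ of m with exactly n (positive) parts.  Every such partition
-- is a weakly increasing list of length n with entries in {1,…,m}.
GFcoeff : ℕ → Series
GFcoeff n m = sumℤ (map term (listsOf n (map suc (upTo m))))
  where
  term : List ℕ → ℤ
  term λ' = if sortedᵇ λ' ∧ (sum λ' ≡ᵇ m) ∧ admissibleᵇ λ' then sign λ' else + 0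

GF : ℤ → Series
GF (+ n) = GFcoeff n
GF -[1+ _ ] = λ _ → + 0

infixl 6 _⊕_ _⊖_
infixr 7 q^_·_

_⊕_ : Series → Series → Series
(F ⊕ G) m = F m ℤ.+ G m

_⊖_ : Series → Series → Series
(F ⊖ G) m = F m ℤ.- G m

⊝_ : Series → Series
(⊝ F) m = ℤ.- F m

q^_·_ : ℕ → Series → Series
(q^ e · F) m = if e ≤ᵇ m then F (m ∸ e) else + 0

module Submission where

-- The coefficient of q^m in GF_n is a signed sum over the weakly increasing lists of n positive parts
-- with sum m.  On such lists the weight (sign on admissible partitions, 0 otherwise) is multiplicative:
-- it is 0 unless every value occurs at most twice, and otherwise the product of w(s) over SIG, where
-- w(s) = 0, -1, 1 for s ≡ 0, 1, 2 mod 3, times (-1)^|μ₂|.  The second neighbourliness condition comes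
-- for free, since a part without a neighbour is an isolated single part and puts an entry 0 into SIG.
-- The weight is invariant under adding 1 to every part, so q^n GF_n counts the partitions with
-- smallest part ≥ 2 and (1 - q^n) GF_n those with smallest part 1.  Sort these by how they begin:
-- the beginnings 1 ≥3, 1 1 1, 1 1 2 2, 1 2 2 2, 1 2 3 3 and 1 2 2 3 3 create a SIG entry divisible by 3
-- or a triple, while 1 1 ≥3, 1 1 2 ≥3, 1 2 ≥4, 1 2 3 ≥4, 1 2 2 ≥4 and 1 2 2 3 ≥4 multiply the weight
-- of the remaining parts by ±1.  Shifting those remaining parts down to parts ≥ 1 produces the terms
-- q^e GF_{n-2}, q^e GF_{n-3} and q^e GF_{n-4} of the recurrence.

open import Defs
open import Data.Bool using (Bool; true; false; _∧_; not; if_then_else_; T)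
open import Data.Bool.Properties using (T-≡; T-∧; ∧-zeroʳ; ∨-zeroʳ)
open import Data.Empty using (⊥-elim)
open import Data.Integer as ℤ using (ℤ; +_; -[1+_]; _-_)
import Data.Integer.Properties as ℤ
open import Data.List using (List; []; _∷_; map; concatMap; applyUpTo; _++_; filterᵇ; length; drop; lookup; tabulate; allFin)
open import Data.Fin as Fin using (Fin; toℕ)
open import Data.Bool.ListAction using (all; any)
open import Data.List.Relation.Unary.All as All using (All; []; _∷_)
open import Data.List.Relation.Unary.All.Properties using (filter⁺; drop⁺)
open import Relation.Nullary.Decidable using (T?)
import Data.List.Properties as List
open import Data.Nat using (ℕ; zero; suc; _+_; _*_; _∸_; _≤_; _<_; z≤n; s≤s; s≤s⁻¹; z<s; _≡ᵇ_; _≤ᵇ_; ∣_-_∣; _%_)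
open import Data.Nat.DivMod using ([m+n]%n≡m%n)
open import Data.Integer.Tactic.RingSolver using (solve-∀)
open import Algebra.Properties.CommutativeSemigroup ℤ.*-commutativeSemigroup using (interchange)
open import Data.Nat.ListAction using (sum)
open import Data.Nat.Properties
open import Data.Product using (Σ; _×_; _,_; proj₁; proj₂)
open import Data.Sum using (_⊎_; inj₁; inj₂)
open import Data.Unit using (tt)
open import Function using (id; _∘_; Equivalence)
open import Relation.Binary.PropositionalEquality
open import Relation.Nullary.Reflects using (ofʸ; ofⁿ)
import Relation.Binary.Reasoning.Setoid as SetoidReasoning

open Equivalence using (to)

T-injective : ∀ {a b : Bool} → (T a → T b) → (T b → T a) → a ≡ b
T-injective {false} {false} _ _ = refl
T-injective {false} {true}  _ g = ⊥-elim (g tt)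
T-injective {true}  {false} f _ = ⊥-elim (f tt)
T-injective {true}  {true}  _ _ = refl

≤ᵇ-dichotomy : ∀ m n → ((m ≤ᵇ n) ≡ true × m ≤ n) ⊎ ((m ≤ᵇ n) ≡ false × n < m)
≤ᵇ-dichotomy m n with m ≤ᵇ n | ≤ᵇ-reflects-≤ m n
... | true  | ofʸ m≤n = inj₁ (refl , m≤n)
... | false | ofⁿ m≰n = inj₂ (refl , ≰⇒> m≰n)

≤⇒≤ᵇ≡true : ∀ {m n} → m ≤ n → (m ≤ᵇ n) ≡ true
≤⇒≤ᵇ≡true m≤n = to T-≡ (≤⇒≤ᵇ m≤n)

>⇒≤ᵇ≡false : ∀ {m n} → n < m → (m ≤ᵇ n) ≡ false
>⇒≤ᵇ≡false {m} {n} n<m with ≤ᵇ-dichotomy m n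
... | inj₁ (_ , m≤n) = ⊥-elim (<⇒≱ n<m m≤n)
... | inj₂ (e , _)   = e

if-false : ∀ {b : Bool} {x : ℤ} → b ≡ false → (if b then x else + 0) ≡ + 0
if-false refl = refl

if-true : ∀ {b : Bool} {x y : ℤ} → b ≡ true → (if b then x else y) ≡ x
if-true refl = refl

≤ᵇ-∸ : ∀ n m k → k ≤ m → (n ≤ᵇ m ∸ k) ≡ (n + k ≤ᵇ m)
≤ᵇ-∸ n m k k≤m = T-injective
  (λ t → ≤⇒≤ᵇ (m≤o∸n⇒m+n≤o n k≤m (≤ᵇ⇒≤ n (m ∸ k) t)))
  (λ t → ≤⇒≤ᵇ (m+n≤o⇒m≤o∸n n (≤ᵇ⇒≤ (n + k) m t)))

interval : ℕ → ℕ → List ℕ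
interval a zero    = []
interval a (suc k) = a ∷ interval (suc a) k

∑ : List ℕ → (ℕ → ℤ) → ℤ
∑ []       h = + 0
∑ (x ∷ xs) h = h x ℤ.+ ∑ xs h

∑-cong : ∀ a k {h h′ : ℕ → ℤ} → (∀ x → a ≤ x → x < a + k → h x ≡ h′ x) →
         ∑ (interval a k) h ≡ ∑ (interval a k) h′
∑-cong a zero    eq = refl
∑-cong a (suc k) eq = cong₂ ℤ._+_
  (eq a ≤-refl (m<m+n a z<s))
  (∑-cong (suc a) k (λ x a<x x<a+k → eq x (<⇒≤ a<x) (subst (x <_) (sym (+-suc a k)) x<a+k)))

∑-zero : ∀ a k {h : ℕ → ℤ} → (∀ x → a ≤ x → x < a + k → h x ≡ + 0) → ∑ (interval a k) h ≡ + 0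
∑-zero a zero    eq = refl
∑-zero a (suc k) eq = trans
  (cong₂ ℤ._+_ (eq a ≤-refl (m<m+n a z<s))
               (∑-zero (suc a) k (λ x a<x x<a+k → eq x (<⇒≤ a<x) (subst (x <_) (sym (+-suc a k)) x<a+k))))
  (ℤ.+-identityˡ _)

∑-neg : ∀ xs (h : ℕ → ℤ) → ∑ xs (λ x → ℤ.- h x) ≡ ℤ.- ∑ xs h
∑-neg []       h = refl
∑-neg (x ∷ xs) h = trans (cong (λ z → ℤ.- h x ℤ.+ z) (∑-neg xs h)) (sym (ℤ.neg-distrib-+ (h x) (∑ xs h)))

∑-suc : ∀ a k (h : ℕ → ℤ) → ∑ (interval (suc a) k) h ≡ ∑ (interval a k) (h ∘ suc)
∑-suc a zero    h = refl
∑-suc a (suc k) h = cong (λ z → h (suc a) ℤ.+ z) (∑-suc (suc a) k h)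

∑-truncate : ∀ a k c (h : ℕ → ℤ) → c < a + k →
             ∑ (interval a k) (λ y → if y ≤ᵇ c then h y else + 0) ≡ ∑ (interval a (suc c ∸ a)) h
∑-truncate a zero c h c<a+0 rewrite m≤n⇒m∸n≡0 (subst (c <_) (+-identityʳ a) c<a+0) = refl
∑-truncate a (suc k) c h c<a+k with ≤ᵇ-dichotomy a c
... | inj₁ (e , a≤c) rewrite e | +-∸-assoc 1 a≤c =
  cong (λ z → h a ℤ.+ z) (∑-truncate (suc a) k c h (subst (c <_) (+-suc a k) c<a+k))
... | inj₂ (e , c<a) rewrite e | m≤n⇒m∸n≡0 c<a = trans (ℤ.+-identityˡ _)
  (∑-zero (suc a) k (λ y a<y _ → if-false (>⇒≤ᵇ≡false (<-trans c<a a<y))))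

∑-window : ∀ a k b c (h : ℕ → ℤ) → a ≤ b → c < a + k →
           ∑ (interval a k) (λ y → if b ≤ᵇ y then (if y ≤ᵇ c then h y else + 0) else + 0)
             ≡ ∑ (interval b (suc c ∸ b)) h
∑-window a zero b c h a≤b c<a+0 =
  cong (λ k → ∑ (interval b k) h) (sym (m≤n⇒m∸n≡0 (≤-trans (subst (c <_) (+-identityʳ a) c<a+0) a≤b)))
∑-window a (suc k) b c h a≤b c<a+k with ≤ᵇ-dichotomy b a
... | inj₂ (e , a<b) rewrite e =
  trans (ℤ.+-identityˡ _) (∑-window (suc a) k b c h a<b (subst (c <_) (+-suc a k) c<a+k))
... | inj₁ (e , b≤a) with ≤-antisym a≤b b≤a
...   | refl = trans (∑-cong a (suc k) (λ y a≤y _ → if-true (≤⇒≤ᵇ≡true a≤y))) (∑-truncate a (suc k) c h c<a+k)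

0ˢ : Series
0ˢ _ = + 0

q^-cong : ∀ e {F G : Series} → F ≗ G → q^ e · F ≗ q^ e · G
q^-cong e F≗G m with e ≤ᵇ m
... | true  = F≗G (m ∸ e)
... | false = refl

q^-0ˢ : ∀ e → q^ e · 0ˢ ≗ 0ˢ
q^-0ˢ e m with e ≤ᵇ m
... | true  = refl
... | false = refl

q^-⊕ : ∀ e (F G : Series) → q^ e · (F ⊕ G) ≗ q^ e · F ⊕ q^ e · G
q^-⊕ e F G m with e ≤ᵇ m
... | true  = refl
... | false = refl

q^-⊝ : ∀ e (F : Series) → q^ e · (⊝ F) ≗ ⊝ (q^ e · F)
q^-⊝ e F m with e ≤ᵇ m
... | true  = refl
... | false = refl

q^-q^ : ∀ a b (F : Series) → q^ a · q^ b · F ≗ q^ (a + b) · F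
q^-q^ a b F m with ≤ᵇ-dichotomy a m
... | inj₁ (e , a≤m) rewrite e | ≤ᵇ-∸ b m a a≤m | +-comm b a | ∸-+-assoc m a b = refl
... | inj₂ (e , m<a) rewrite e = sym (if-false (>⇒≤ᵇ≡false (<-≤-trans m<a (m≤m+n a b))))

⊕-cong : ∀ {F F′ G G′ : Series} → F ≗ F′ → G ≗ G′ → F ⊕ G ≗ F′ ⊕ G′
⊕-cong F≗F′ G≗G′ m = cong₂ ℤ._+_ (F≗F′ m) (G≗G′ m)

⊕-congˡ : ∀ {F F′ : Series} G → F ≗ F′ → F ⊕ G ≗ F′ ⊕ G
⊕-congˡ G F≗F′ m = cong (ℤ._+ G m) (F≗F′ m)

⊕-congʳ : ∀ F {G G′ : Series} → G ≗ G′ → F ⊕ G ≗ F ⊕ G′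
⊕-congʳ F G≗G′ m = cong (λ z → F m ℤ.+ z) (G≗G′ m)

-- Sums over weakly increasing lists

data Sorted≥ : ℕ → List ℕ → Set where
  []  : ∀ {p} → Sorted≥ p []
  _∷_ : ∀ {p x xs} → p ≤ x → Sorted≥ x xs → Sorted≥ p (x ∷ xs)

-- ΣSorted n p f m sums f over the weakly increasing lists of length n, parts ≥ p and sum m.
ΣSorted : ℕ → ℕ → (List ℕ → ℤ) → Series
ΣSorted zero    p f m = if 0 ≡ᵇ m then f [] else + 0
ΣSorted (suc n) p f m = ∑ (interval p (suc m ∸ p)) (λ x → ΣSorted n x (f ∘ (x ∷_)) (m ∸ x))

ΣSorted-cong : ∀ n p {f g : List ℕ → ℤ} → (∀ l → Sorted≥ p l → f l ≡ g l) → ΣSorted n p f ≗ ΣSorted n p g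
ΣSorted-cong zero    p eq m = cong (λ z → if 0 ≡ᵇ m then z else + 0) (eq [] [])
ΣSorted-cong (suc n) p eq m =
  ∑-cong p (suc m ∸ p) (λ x p≤x _ → ΣSorted-cong n x (λ l sl → eq (x ∷ l) (p≤x ∷ sl)) (m ∸ x))

ΣSorted-zero : ∀ n p {f : List ℕ → ℤ} → (∀ l → Sorted≥ p l → f l ≡ + 0) → ΣSorted n p f ≗ 0ˢ
ΣSorted-zero zero p eq m with 0 ≡ᵇ m
... | true  = eq [] []
... | false = refl
ΣSorted-zero (suc n) p eq m =
  ∑-zero p (suc m ∸ p) (λ x p≤x _ → ΣSorted-zero n x (λ l sl → eq (x ∷ l) (p≤x ∷ sl)) (m ∸ x))

ΣSorted-neg : ∀ n p (f : List ℕ → ℤ) → ΣSorted n p (λ l → ℤ.- f l) ≗ ⊝ ΣSorted n p f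
ΣSorted-neg zero p f m with 0 ≡ᵇ m
... | true  = refl
... | false = refl
ΣSorted-neg (suc n) p f m =
  trans (∑-cong p (suc m ∸ p) (λ x _ _ → ΣSorted-neg n x (f ∘ (x ∷_)) (m ∸ x)))
        (∑-neg (interval p (suc m ∸ p)) (λ x → ΣSorted n x (f ∘ (x ∷_)) (m ∸ x)))

ΣSorted-split : ∀ n p (f : List ℕ → ℤ) →
                ΣSorted (suc n) p f ≗ q^ p · ΣSorted n p (f ∘ (p ∷_)) ⊕ ΣSorted (suc n) (suc p) f
ΣSorted-split n p f m with ≤ᵇ-dichotomy p m
... | inj₁ (e , p≤m) rewrite e | +-∸-assoc 1 p≤m = refl
... | inj₂ (e , m<p) rewrite e | m≤n⇒m∸n≡0 m<p | m≤n⇒m∸n≡0 (<⇒≤ m<p) = refl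

y<p+[m∸p]⇒y<m : ∀ {p m y} → p ≤ y → y < p + (m ∸ p) → y < m
y<p+[m∸p]⇒y<m {p} {m} {y} p≤y y<p+m∸p with ≤ᵇ-dichotomy p m
... | inj₁ (_ , p≤m) = subst (y <_) (m+[n∸m]≡n p≤m) y<p+m∸p
... | inj₂ (_ , m<p) =
  ⊥-elim (<⇒≱ (subst (y <_) (trans (cong (λ k → p + k) (m≤n⇒m∸n≡0 (<⇒≤ m<p))) (+-identityʳ p)) y<p+m∸p) p≤y)

ΣSorted-shift : ∀ n p (f : List ℕ → ℤ) → ΣSorted n (suc p) f ≗ q^ n · ΣSorted n p (f ∘ map suc)
ΣSorted-shift zero    p f m = refl
ΣSorted-shift (suc n) p f m with ≤ᵇ-dichotomy (suc n) m
... | inj₁ (e , n<m) rewrite e = begin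
    ∑ (interval (suc p) (m ∸ p)) (λ x → ΣSorted n x (f ∘ (x ∷_)) (m ∸ x))
  ≡⟨ ∑-suc p (m ∸ p) _ ⟩
    ∑ (interval p (m ∸ p)) (λ y → ΣSorted n (suc y) (f ∘ (suc y ∷_)) (m ∸ suc y))
  ≡⟨ ∑-cong p (m ∸ p) (λ y p≤y y<p+m∸p →
       trans (ΣSorted-shift n y _ (m ∸ suc y)) (shifted y (y<p+[m∸p]⇒y<m p≤y y<p+m∸p))) ⟩
    ∑ (interval p (m ∸ p)) (λ y → if y ≤ᵇ m ∸ suc n then G y (m ∸ suc n ∸ y) else + 0)
  ≡⟨ ∑-truncate p (m ∸ p) (m ∸ suc n) _ (<-≤-trans (∸-monoʳ-< z<s n<m) (m≤n+m∸n m p)) ⟩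
    ∑ (interval p (suc (m ∸ suc n) ∸ p)) (λ y → G y (m ∸ suc n ∸ y))
  ∎
  where
  open ≡-Reasoning
  G : ℕ → Series
  G y = ΣSorted n y (f ∘ (suc y ∷_) ∘ map suc)
  shifted : ∀ y → y < m →
            (q^ n · G y) (m ∸ suc y) ≡ (if y ≤ᵇ m ∸ suc n then G y (m ∸ suc n ∸ y) else + 0)
  shifted y y<m = cong₂ (λ b k → if b then G y k else + 0)
    (trans (≤ᵇ-∸ n m (suc y) y<m)
           (trans (cong (_≤ᵇ m) (trans (+-suc n y) (trans (cong suc (+-comm n y)) (sym (+-suc y n)))))
                  (sym (≤ᵇ-∸ y m (suc n) n<m))))
    (trans (∸-+-assoc m (suc y) n)
           (trans (cong (λ k → m ∸ suc k) (+-comm y n)) (sym (∸-+-assoc m (suc n) y))))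
... | inj₂ (e , m≤n) rewrite e =
  trans (∑-suc p (m ∸ p) _)
        (∑-zero p (m ∸ p) (λ y p≤y y<p+m∸p →
           trans (ΣSorted-shift n y _ (m ∸ suc y))
                 (if-false (>⇒≤ᵇ≡false (<-≤-trans (∸-monoʳ-< z<s (y<p+[m∸p]⇒y<m p≤y y<p+m∸p)) (s≤s⁻¹ m≤n))))))

-- The generating function as a sum over weakly increasing lists

sumℤ-++ : ∀ (xs ys : List ℤ) → sumℤ (xs ++ ys) ≡ sumℤ xs ℤ.+ sumℤ ys
sumℤ-++ []       ys = sym (ℤ.+-identityˡ _)
sumℤ-++ (x ∷ xs) ys = trans (cong (λ z → x ℤ.+ z) (sumℤ-++ xs ys)) (sym (ℤ.+-assoc x _ _))

sumℤ-map-if : ∀ (b : Bool) (F : List ℕ → ℤ) (X : List (List ℕ)) →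
              sumℤ (map (λ l → if b then F l else + 0) X) ≡ (if b then sumℤ (map F X) else + 0)
sumℤ-map-if true  F X       = refl
sumℤ-map-if false F []      = refl
sumℤ-map-if false F (x ∷ X) = trans (ℤ.+-identityˡ _) (sumℤ-map-if false F X)

sumℤ-concatMap-prepend : ∀ (K : List ℕ) (X : List (List ℕ)) (F : List ℕ → ℤ) →
  sumℤ (map F (concatMap (λ x → map (x ∷_) X) K)) ≡ ∑ K (λ x → sumℤ (map (F ∘ (x ∷_)) X))
sumℤ-concatMap-prepend []      X F = refl
sumℤ-concatMap-prepend (x ∷ K) X F = begin
    sumℤ (map F (map (x ∷_) X ++ concatMap (λ y → map (y ∷_) X) K))
  ≡⟨ cong sumℤ (List.map-++ F (map (x ∷_) X) _) ⟩
    sumℤ (map F (map (x ∷_) X) ++ map F (concatMap (λ y → map (y ∷_) X) K))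
  ≡⟨ sumℤ-++ (map F (map (x ∷_) X)) _ ⟩
    sumℤ (map F (map (x ∷_) X)) ℤ.+ sumℤ (map F (concatMap (λ y → map (y ∷_) X) K))
  ≡⟨ cong₂ ℤ._+_ (cong sumℤ (sym (List.map-∘ X))) (sumℤ-concatMap-prepend K X F) ⟩
    sumℤ (map (F ∘ (x ∷_)) X) ℤ.+ ∑ K (λ y → sumℤ (map (F ∘ (y ∷_)) X))
  ∎
  where open ≡-Reasoning

map-suc-applyUpTo : ∀ k (f : ℕ → ℕ) a → (∀ i → f i ≡ a + i) → map suc (applyUpTo f k) ≡ interval (suc a) k
map-suc-applyUpTo zero    f a eq = refl
map-suc-applyUpTo (suc k) f a eq = cong₂ _∷_
  (cong suc (trans (eq 0) (+-identityʳ a)))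
  (map-suc-applyUpTo k (f ∘ suc) (suc a) (λ i → trans (eq (suc i)) (+-suc a i)))

sum≡ᵇ-∷ : ∀ x s m → (x + s ≡ᵇ m) ≡ ((x ≤ᵇ m) ∧ (s ≡ᵇ m ∸ x))
sum≡ᵇ-∷ x s m = T-injective to′ from′
  where
  to′ : T (x + s ≡ᵇ m) → T ((x ≤ᵇ m) ∧ (s ≡ᵇ m ∸ x))
  to′ t with ≡ᵇ⇒≡ (x + s) m t
  ... | refl = Equivalence.from T-∧ (≤⇒≤ᵇ (m≤m+n x s) , ≡⇒≡ᵇ s (x + s ∸ x) (sym (m+n∸m≡n x s)))
  from′ : T ((x ≤ᵇ m) ∧ (s ≡ᵇ m ∸ x)) → T (x + s ≡ᵇ m)
  from′ t with to T-∧ t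
  ... | x≤m , s≡m∸x with ≡ᵇ⇒≡ s (m ∸ x) s≡m∸x
  ...   | refl = ≡⇒≡ᵇ (x + (m ∸ x)) m (m+[n∸m]≡n (≤ᵇ⇒≤ x m x≤m))

-- The summand of GFcoeff, with test and sign abstracted so that the induction can prefix them.
restrict : (List ℕ → Bool) → (List ℕ → ℤ) → ℕ → List ℕ → ℤ
restrict A S m l = if sortedᵇ l ∧ (sum l ≡ᵇ m) ∧ A l then S l else + 0

when : (List ℕ → Bool) → (List ℕ → ℤ) → List ℕ → ℤ
when A S l = if A l then S l else + 0

restrict-∷∷ : ∀ A S m x y l → restrict A S m (x ∷ y ∷ l) ≡
  (if x ≤ᵇ y then (if x ≤ᵇ m then restrict (A ∘ (x ∷_)) (S ∘ (x ∷_)) (m ∸ x) (y ∷ l) else + 0) else + 0)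
restrict-∷∷ A S m x y l rewrite sum≡ᵇ-∷ x (y + sum l) m with x ≤ᵇ y | x ≤ᵇ m | sortedᵇ (y ∷ l)
... | false | _     | _     = refl
... | true  | false | false = refl
... | true  | false | true  = refl
... | true  | true  | false = refl
... | true  | true  | true  = refl

sumℤ-restrict-∷ : ∀ n M x m A S → 1 ≤ x → m ≤ M →
  sumℤ (map (restrict A S m ∘ (x ∷_)) (listsOf n (interval 1 M))) ≡ (q^ x · ΣSorted n x (when A S ∘ (x ∷_))) m
sumℤ-restrict-∷ zero M x m A S _ _ = trans (ℤ.+-identityʳ _) single
  where
  single : restrict A S m (x ∷ []) ≡ (q^ x · ΣSorted zero x (when A S ∘ (x ∷_))) m
  single rewrite sum≡ᵇ-∷ x 0 m with x ≤ᵇ m | 0 ≡ᵇ m ∸ x | A (x ∷ [])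
  ... | false | _     | _     = refl
  ... | true  | false | _     = refl
  ... | true  | true  | false = refl
  ... | true  | true  | true  = refl
sumℤ-restrict-∷ (suc n) M x m A S 1≤x m≤M =
  trans (sumℤ-concatMap-prepend (interval 1 M) (listsOf n (interval 1 M)) _)
        (trans (∑-cong 1 M (λ y 1≤y _ → summand≡ y 1≤y)) (∑summand≡ (≤ᵇ-dichotomy x m)))
  where
  summand : ℕ → ℤ
  summand y =
    if x ≤ᵇ y then (if x ≤ᵇ m then (q^ y · ΣSorted n y (when A S ∘ (x ∷_) ∘ (y ∷_))) (m ∸ x) else + 0) else + 0
  summand≡ : ∀ y → 1 ≤ y → sumℤ (map (restrict A S m ∘ (x ∷_) ∘ (y ∷_)) (listsOf n (interval 1 M))) ≡ summand y
  summand≡ y 1≤y =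
    trans (cong sumℤ (List.map-cong (restrict-∷∷ A S m x y) (listsOf n (interval 1 M))))
    (trans (sumℤ-map-if (x ≤ᵇ y) _ (listsOf n (interval 1 M)))
    (cong (λ z → if x ≤ᵇ y then z else + 0)
      (trans (sumℤ-map-if (x ≤ᵇ m) _ (listsOf n (interval 1 M)))
       (cong (λ z → if x ≤ᵇ m then z else + 0)
         (sumℤ-restrict-∷ n M y (m ∸ x) (A ∘ (x ∷_)) (S ∘ (x ∷_)) 1≤y (≤-trans (m∸n≤m m x) m≤M))))))
  ∑summand≡ : ((x ≤ᵇ m) ≡ true × x ≤ m) ⊎ ((x ≤ᵇ m) ≡ false × m < x) →
          ∑ (interval 1 M) summand ≡ (q^ x · ΣSorted (suc n) x (when A S ∘ (x ∷_))) m
  ∑summand≡ (inj₁ (e , _)) rewrite e = ∑-window 1 M x (m ∸ x) _ 1≤x (s≤s (≤-trans (m∸n≤m m x) m≤M))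
  ∑summand≡ (inj₂ (e , _)) rewrite e = ∑-zero 1 M (λ y _ _ → vanish (x ≤ᵇ y))
    where
    vanish : ∀ b → (if b then + 0 else + 0) ≡ + 0
    vanish true  = refl
    vanish false = refl

GFcoeff≗ΣSorted : ∀ n → GFcoeff n ≗ ΣSorted n 1 (when admissibleᵇ sign)
GFcoeff≗ΣSorted zero m with 0 ≡ᵇ m
... | true  = ℤ.+-identityʳ _
... | false = refl
GFcoeff≗ΣSorted (suc n) m rewrite map-suc-applyUpTo m (λ i → i) 0 (λ i → refl) =
  trans (sumℤ-concatMap-prepend (interval 1 m) (listsOf n (interval 1 m)) _)
        (∑-cong 1 m (λ x 1≤x x<1+m →
           trans (sumℤ-restrict-∷ n m x m admissibleᵇ sign 1≤x ≤-refl) (if-true (≤⇒≤ᵇ≡true (s≤s⁻¹ x<1+m)))))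

-- Multiplicities

filterᵇ-accept : ∀ {A : Set} (p : A → Bool) x xs → p x ≡ true → filterᵇ p (x ∷ xs) ≡ x ∷ filterᵇ p xs
filterᵇ-accept p x xs e rewrite e = refl

filterᵇ-reject : ∀ {A : Set} (p : A → Bool) x xs → p x ≡ false → filterᵇ p (x ∷ xs) ≡ filterᵇ p xs
filterᵇ-reject p x xs e rewrite e = refl

filterᵇ-all : ∀ {A : Set} (p : A → Bool) xs → All (λ y → p y ≡ true) xs → filterᵇ p xs ≡ xs
filterᵇ-all p []       []       = refl
filterᵇ-all p (x ∷ xs) (e ∷ es) = trans (filterᵇ-accept p x xs e) (cong (x ∷_) (filterᵇ-all p xs es))

filterᵇ-none : ∀ {A : Set} (p : A → Bool) xs → All (λ y → p y ≡ false) xs → filterᵇ p xs ≡ []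
filterᵇ-none p []       []       = refl
filterᵇ-none p (x ∷ xs) (e ∷ es) = trans (filterᵇ-reject p x xs e) (filterᵇ-none p xs es)

filterᵇ-cong : ∀ {A : Set} (p q : A → Bool) xs → All (λ y → p y ≡ q y) xs → filterᵇ p xs ≡ filterᵇ q xs
filterᵇ-cong p q []       []       = refl
filterᵇ-cong p q (x ∷ xs) (e ∷ es) = by-head (q x) refl
  where
  by-head : ∀ b → q x ≡ b → filterᵇ p (x ∷ xs) ≡ filterᵇ q (x ∷ xs)
  by-head true  qx = trans (filterᵇ-accept p x xs (trans e qx))
                           (trans (cong (x ∷_) (filterᵇ-cong p q xs es)) (sym (filterᵇ-accept q x xs qx)))
  by-head false qx = trans (filterᵇ-reject p x xs (trans e qx))
                           (trans (filterᵇ-cong p q xs es) (sym (filterᵇ-reject q x xs qx)))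

All-filterᵇ : ∀ {A : Set} {P : A → Set} (p : A → Bool) {xs} → All P xs → All P (filterᵇ p xs)
All-filterᵇ p = filter⁺ (T? ∘ p)

all-cong : ∀ {A : Set} (p q : A → Bool) xs → All (λ y → p y ≡ q y) xs → all p xs ≡ all q xs
all-cong p q []       []       = refl
all-cong p q (x ∷ xs) (e ∷ es) = cong₂ _∧_ e (all-cong p q xs es)

≡ᵇ-refl : ∀ x → (x ≡ᵇ x) ≡ true
≡ᵇ-refl x = to T-≡ (≡⇒≡ᵇ x x refl)

≢⇒≡ᵇ≡false : ∀ {x y} → x ≢ y → (x ≡ᵇ y) ≡ false
≢⇒≡ᵇ≡false {x} {y} x≢y with x ≡ᵇ y in eq
... | false = refl
... | true  = ⊥-elim (x≢y (≡ᵇ⇒≡ x y (subst T (sym eq) tt)))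

All-nub : ∀ {P : ℕ → Set} xs → All P xs → All P (nub xs)
All-nub []       []       = []
All-nub (x ∷ xs) (a ∷ as) = a ∷ All-filterᵇ _ (All-nub xs as)

count-∷-≡ : ∀ x l → count x (x ∷ l) ≡ suc (count x l)
count-∷-≡ x l rewrite ≡ᵇ-refl x = refl

count-∷-≢ : ∀ {v x} l → v ≢ x → count v (x ∷ l) ≡ count v l
count-∷-≢ l v≢x rewrite ≢⇒≡ᵇ≡false v≢x = refl

count-below : ∀ x l → All (x <_) l → count x l ≡ 0
count-below x []      []          = refl
count-below x (y ∷ l) (x<y ∷ x<l) rewrite ≢⇒≡ᵇ≡false (<⇒≢ x<y) = count-below x l x<l

counts-∷ : ∀ {x} l ys → All (x <_) ys → All (λ v → count v (x ∷ l) ≡ count v l) ys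
counts-∷ l ys x<ys = All.map (λ x<v → count-∷-≢ l (>⇒≢ x<v)) x<ys

counts-∷∷ : ∀ {x} l ys → All (x <_) ys → All (λ v → count v (x ∷ x ∷ l) ≡ count v l) ys
counts-∷∷ l ys x<ys = All.map (λ x<v → trans (count-∷-≢ (_ ∷ l) (>⇒≢ x<v)) (count-∷-≢ l (>⇒≢ x<v))) x<ys

nub-∷ : ∀ x μ → All (x <_) μ → nub (x ∷ μ) ≡ x ∷ nub μ
nub-∷ x μ x<μ = cong (x ∷_) (filterᵇ-all _ (nub μ) (All-nub μ (All.map (λ x<y → cong not (≢⇒≡ᵇ≡false (<⇒≢ x<y))) x<μ)))

nub-∷∷ : ∀ x μ → All (x <_) μ → nub (x ∷ x ∷ μ) ≡ x ∷ nub μ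
nub-∷∷ x μ x<μ = cong (x ∷_)
  (trans (filterᵇ-reject (λ y → not (x ≡ᵇ y)) x _ (cong not (≡ᵇ-refl x)))
         (trans (cong (filterᵇ (λ y → not (x ≡ᵇ y))) (filterᵇ-all _ (nub μ) x≢nub)) (filterᵇ-all _ (nub μ) x≢nub)))
  where
  x≢nub : All (λ y → not (x ≡ᵇ y) ≡ true) (nub μ)
  x≢nub = All-nub μ (All.map (λ x<y → cong not (≢⇒≡ᵇ≡false (<⇒≢ x<y))) x<μ)

μ₂-∷ : ∀ x μ → All (x <_) μ → μ₂ (x ∷ μ) ≡ μ₂ μ
μ₂-∷ x μ x<μ = trans (cong (filterᵇ (λ v → 2 ≤ᵇ count v (x ∷ μ))) (nub-∷ x μ x<μ))
  (trans (filterᵇ-reject _ x (nub μ) (cong (2 ≤ᵇ_) (trans (count-∷-≡ x μ) (cong suc (count-below x μ x<μ)))))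
         (filterᵇ-cong _ _ (nub μ) (All.map (cong (2 ≤ᵇ_)) (counts-∷ μ (nub μ) (All-nub μ x<μ)))))

μ₂-∷∷ : ∀ x μ → All (x <_) μ → μ₂ (x ∷ x ∷ μ) ≡ x ∷ μ₂ μ
μ₂-∷∷ x μ x<μ = trans (cong (filterᵇ (λ v → 2 ≤ᵇ count v (x ∷ x ∷ μ))) (nub-∷∷ x μ x<μ))
  (trans (filterᵇ-accept _ x (nub μ)
            (cong (2 ≤ᵇ_) (trans (count-∷-≡ x (x ∷ μ)) (cong suc (trans (count-∷-≡ x μ) (cong suc (count-below x μ x<μ)))))))
         (cong (x ∷_) (filterᵇ-cong _ _ (nub μ) (All.map (cong (2 ≤ᵇ_)) (counts-∷∷ μ (nub μ) (All-nub μ x<μ))))))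

atMostTwiceᵇ : List ℕ → Bool
atMostTwiceᵇ l = all (λ v → count v l ≤ᵇ 2) l

atMostTwiceᵇ-∷ : ∀ x μ → All (x <_) μ → atMostTwiceᵇ (x ∷ μ) ≡ atMostTwiceᵇ μ
atMostTwiceᵇ-∷ x μ x<μ rewrite count-∷-≡ x μ | count-below x μ x<μ =
  all-cong _ _ μ (All.map (cong (_≤ᵇ 2)) (counts-∷ μ μ x<μ))

atMostTwiceᵇ-∷∷ : ∀ x μ → All (x <_) μ → atMostTwiceᵇ (x ∷ x ∷ μ) ≡ atMostTwiceᵇ μ
atMostTwiceᵇ-∷∷ x μ x<μ rewrite count-∷-≡ x (x ∷ μ) | count-∷-≡ x μ | count-below x μ x<μ =
  all-cong _ _ μ (All.map (cong (_≤ᵇ 2)) (counts-∷∷ μ μ x<μ))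

atMostTwiceᵇ-triple : ∀ x μ → atMostTwiceᵇ (x ∷ x ∷ x ∷ μ) ≡ false
atMostTwiceᵇ-triple x μ rewrite count-∷-≡ x (x ∷ x ∷ μ) | count-∷-≡ x (x ∷ μ) | count-∷-≡ x μ = refl

-- Components and SIG

Sorted≥⇒All≤ : ∀ {b l} → Sorted≥ b l → All (b ≤_) l
Sorted≥⇒All≤ []          = []
Sorted≥⇒All≤ (b≤x ∷ sxs) = b≤x ∷ All.map (≤-trans b≤x) (Sorted≥⇒All≤ sxs)

inRun : ℕ → ℕ → ℕ → Bool
inRun k n a = (k ≤ᵇ a) ∧ (a ≤ᵇ n)

component : List ℕ → ℕ × ℕ → List ℕ
component D (k , n) = sigComp k n (filterᵇ (inRun k n) D)

runs-∷ : ∀ y ys → Σ ℕ λ n → Σ (List (ℕ × ℕ)) λ rs → runs (y ∷ ys) ≡ (y , n) ∷ rs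
runs-∷ y ys with runs ys
... | [] = y , [] , refl
... | (k , n) ∷ rs with suc y ≡ᵇ k
...   | true  = n , rs , refl
...   | false = y , (k , n) ∷ rs , refl

addToRuns-ordered : ∀ x R → All (λ r → proj₁ r ≤ proj₂ r) R → All (λ r → proj₁ r ≤ proj₂ r) (addToRuns x R)
addToRuns-ordered x []             []         = ≤-refl ∷ []
addToRuns-ordered x ((k , n) ∷ rs) (k≤n ∷ ks) with suc x ≡ᵇ k in eq
... | true  = ≤-trans (n≤1+n x) (subst (_≤ n) (sym (≡ᵇ⇒≡ (suc x) k (subst T (sym eq) tt))) k≤n) ∷ ks
... | false = ≤-refl ∷ k≤n ∷ ks

runs-ordered : ∀ d → All (λ r → proj₁ r ≤ proj₂ r) (runs d)
runs-ordered []      = []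
runs-ordered (x ∷ d) = addToRuns-ordered x (runs d) (runs-ordered d)

addToRuns-≥ : ∀ b x R → b ≤ x → All (λ r → b ≤ proj₁ r) R → All (λ r → b ≤ proj₁ r) (addToRuns x R)
addToRuns-≥ b x []             b≤x []         = b≤x ∷ []
addToRuns-≥ b x ((k , n) ∷ rs) b≤x (b≤k ∷ bs) with suc x ≡ᵇ k
... | true  = b≤x ∷ bs
... | false = b≤x ∷ b≤k ∷ bs

runs-≥ : ∀ b d → All (b ≤_) d → All (λ r → b ≤ proj₁ r) (runs d)
runs-≥ b []      []          = []
runs-≥ b (x ∷ d) (b≤x ∷ b≤d) = addToRuns-≥ b x (runs d) b≤x (runs-≥ b d b≤d)

addToRuns-separate : ∀ x R → All (λ r → 2 + x ≤ proj₁ r) R → addToRuns x R ≡ (x , x) ∷ R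
addToRuns-separate x []             []      = refl
addToRuns-separate x ((k , n) ∷ rs) (p ∷ _) rewrite ≢⇒≡ᵇ≡false {suc x} {k} (<⇒≢ p) = refl

addToRuns-merge : ∀ x n rs → addToRuns x ((suc x , n) ∷ rs) ≡ (x , n) ∷ rs
addToRuns-merge x n rs rewrite ≡ᵇ-refl x = refl

mapHead : (ℕ → ℕ) → List ℕ → List ℕ
mapHead f []       = []
mapHead f (a ∷ as) = f a ∷ as

mapHead-sigComp-++ : ∀ f k n F ys → mapHead f (sigComp k n F ++ ys) ≡ mapHead f (sigComp k n F) ++ ys
mapHead-sigComp-++ f k n []      ys = refl
mapHead-sigComp-++ f k n (a ∷ F) ys = refl

inRun-below : ∀ x D → All (x <_) D → filterᵇ (inRun x x) D ≡ []
inRun-below x D x<D = filterᵇ-none _ D (All.map (λ x<y → trans (cong ((x ≤ᵇ _) ∧_) (>⇒≤ᵇ≡false x<y)) (∧-zeroʳ _)) x<D)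

component-∷-below : ∀ x D k n → x < k → component (x ∷ D) (k , n) ≡ component D (k , n)
component-∷-below x D k n x<k = cong (sigComp k n) (filterᵇ-reject _ x D (cong (_∧ (x ≤ᵇ n)) (>⇒≤ᵇ≡false x<k)))

components-∷-below : ∀ x D R → All (λ r → x < proj₁ r) R →
                     concatMap (component (x ∷ D)) R ≡ concatMap (component D) R
components-∷-below x D []             []          = refl
components-∷-below x D ((k , n) ∷ R) (x<k ∷ x<R) =
  cong₂ _++_ (component-∷-below x D k n x<k) (components-∷-below x D R x<R)

∸≡suc∸suc : ∀ {x n} → suc x ≤ n → n ∸ x ≡ suc (n ∸ suc x)
∸≡suc∸suc = +-∸-assoc 1

inRun-suc : ∀ x n D → All (x <_) D → filterᵇ (inRun x n) D ≡ filterᵇ (inRun (suc x) n) D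
inRun-suc x n D x<D =
  filterᵇ-cong _ _ D (All.map (λ x<y → cong (_∧ _) (trans (≤⇒≤ᵇ≡true (<⇒≤ x<y)) (sym (≤⇒≤ᵇ≡true x<y)))) x<D)

inRun-≥ : ∀ x n D → All (x ≤_) (filterᵇ (inRun x n) D)
inRun-≥ x n []      = []
inRun-≥ x n (d ∷ D) with inRun x n d in eq
... | true  = ≤ᵇ⇒≤ x d (proj₁ (to T-∧ (subst T (sym eq) tt))) ∷ inRun-≥ x n D
... | false = inRun-≥ x n D

sigComp-extend : ∀ x n F → suc x ≤ n → All (suc x ≤_) F → sigComp x n F ≡ mapHead suc (sigComp (suc x) n F)
sigComp-extend x n []      x<n _         rewrite ∸≡suc∸suc x<n = refl
sigComp-extend x n (a ∷ F) _   (x<a ∷ _) rewrite ∸≡suc∸suc x<a = refl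

sigTail-extend : ∀ x n F → suc x ≤ n → All (suc x ≤_) F → sigTail n x F ≡ mapHead (λ h → 2 + h) (sigComp (suc x) n F)
sigTail-extend x n []      x<n _         rewrite ∸≡suc∸suc x<n | +-comm (n ∸ suc x) 1 = refl
sigTail-extend x n (a ∷ F) _   (x<a ∷ _) rewrite ∸≡suc∸suc x<a | +-comm (a ∸ suc x) 2 | +-comm (a ∸ suc x) 1 = refl

Sorted≥-weaken : ∀ {a b l} → a ≤ b → Sorted≥ b l → Sorted≥ a l
Sorted≥-weaken a≤b []          = []
Sorted≥-weaken a≤b (b≤x ∷ sxs) = ≤-trans a≤b b≤x ∷ sxs

Sorted≥⇒All> : ∀ {x l} → Sorted≥ (2 + x) l → All (x <_) l
Sorted≥⇒All> s = Sorted≥⇒All≤ (Sorted≥-weaken (n≤1+n _) s)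

SIG-isolated : ∀ x μ → Sorted≥ (2 + x) μ → SIG (x ∷ μ) ≡ 0 ∷ SIG μ
SIG-isolated x μ s = begin
    SIG (x ∷ μ)
  ≡⟨ cong₂ (λ D R → concatMap (component D) R) (μ₂-∷ x μ x<μ) (cong runs (nub-∷ x μ x<μ)) ⟩
    concatMap (component (μ₂ μ)) (addToRuns x (runs (nub μ)))
  ≡⟨ cong (concatMap (component (μ₂ μ))) (addToRuns-separate x _ (runs-≥ _ (nub μ) (All-nub μ (Sorted≥⇒All≤ s)))) ⟩
    sigComp x x (filterᵇ (inRun x x) (μ₂ μ)) ++ SIG μ
  ≡⟨ cong (λ F → sigComp x x F ++ SIG μ) (inRun-below x (μ₂ μ) (All-filterᵇ _ (All-nub μ x<μ))) ⟩
    (x ∸ x) ∷ SIG μ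
  ≡⟨ cong (_∷ SIG μ) (n∸n≡0 x) ⟩
    0 ∷ SIG μ
  ∎
  where
  open ≡-Reasoning
  x<μ = Sorted≥⇒All> s

SIG-isolatedDouble : ∀ x μ → Sorted≥ (2 + x) μ → SIG (x ∷ x ∷ μ) ≡ 1 ∷ 1 ∷ SIG μ
SIG-isolatedDouble x μ s = begin
    SIG (x ∷ x ∷ μ)
  ≡⟨ cong₂ (λ D R → concatMap (component D) R) (μ₂-∷∷ x μ x<μ) (cong runs (nub-∷∷ x μ x<μ)) ⟩
    concatMap (component (x ∷ μ₂ μ)) (addToRuns x (runs (nub μ)))
  ≡⟨ cong (concatMap (component (x ∷ μ₂ μ))) (addToRuns-separate x _ runs≥) ⟩
    sigComp x x (filterᵇ (inRun x x) (x ∷ μ₂ μ)) ++ concatMap (component (x ∷ μ₂ μ)) (runs (nub μ))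
  ≡⟨ cong₂ _++_ (cong (sigComp x x) (trans (filterᵇ-accept _ x (μ₂ μ) (cong₂ _∧_ x≤ᵇx x≤ᵇx))
                                           (cong (x ∷_) (inRun-below x (μ₂ μ) (All-filterᵇ _ (All-nub μ x<μ))))))
                (components-∷-below x (μ₂ μ) (runs (nub μ)) (All.map (≤-trans (n≤1+n _)) runs≥)) ⟩
    (x ∸ x + 1) ∷ (x ∸ x + 1) ∷ SIG μ
  ≡⟨ cong (λ z → z + 1 ∷ z + 1 ∷ SIG μ) (n∸n≡0 x) ⟩
    1 ∷ 1 ∷ SIG μ
  ∎
  where
  open ≡-Reasoning
  x<μ = Sorted≥⇒All> s
  x≤ᵇx = ≤⇒≤ᵇ≡true (≤-refl {x})
  runs≥ = runs-≥ _ (nub μ) (All-nub μ (Sorted≥⇒All≤ s))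

SIG-extend : ∀ x μ′ → Sorted≥ (suc x) μ′ → SIG (x ∷ suc x ∷ μ′) ≡ mapHead suc (SIG (suc x ∷ μ′))
SIG-extend x μ′ s with runs-∷ (suc x) (filterᵇ (λ y → not (suc x ≡ᵇ y)) (nub μ′))
... | n , rs , re = begin
    SIG (x ∷ μ)
  ≡⟨ cong₂ (λ D R → concatMap (component D) R) (μ₂-∷ x μ x<μ) (cong runs (nub-∷ x μ x<μ)) ⟩
    concatMap (component D) (addToRuns x (runs (nub μ)))
  ≡⟨ cong (λ R → concatMap (component D) (addToRuns x R)) re ⟩
    concatMap (component D) (addToRuns x ((suc x , n) ∷ rs))
  ≡⟨ cong (concatMap (component D)) (addToRuns-merge x n rs) ⟩
    sigComp x n (filterᵇ (inRun x n) D) ++ concatMap (component D) rs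
  ≡⟨ cong (_++ concatMap (component D) rs)
          (trans (cong (sigComp x n) (inRun-suc x n D (All-filterᵇ (λ v → 2 ≤ᵇ count v μ) (All-nub μ x<μ))))
                 (sigComp-extend x n _ x<n (inRun-≥ (suc x) n D))) ⟩
    mapHead suc (sigComp (suc x) n (filterᵇ (inRun (suc x) n) D)) ++ concatMap (component D) rs
  ≡⟨ sym (mapHead-sigComp-++ suc (suc x) n (filterᵇ (inRun (suc x) n) D) (concatMap (component D) rs)) ⟩
    mapHead suc (concatMap (component D) ((suc x , n) ∷ rs))
  ≡⟨ cong (λ R → mapHead suc (concatMap (component D) R)) (sym re) ⟩
    mapHead suc (SIG μ)
  ∎
  where
  open ≡-Reasoning
  μ = suc x ∷ μ′
  D = μ₂ μ
  x<μ : All (x <_) μ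
  x<μ = ≤-refl ∷ Sorted≥⇒All≤ s
  x<n : suc x ≤ n
  x<n = All.head (subst (All _) re (runs-ordered (nub μ)))

SIG-extendDouble : ∀ x μ′ → Sorted≥ (suc x) μ′ →
                   SIG (x ∷ x ∷ suc x ∷ μ′) ≡ 1 ∷ mapHead (λ h → 2 + h) (SIG (suc x ∷ μ′))
SIG-extendDouble x μ′ s with runs-∷ (suc x) (filterᵇ (λ y → not (suc x ≡ᵇ y)) (nub μ′))
... | n , rs , re = begin
    SIG (x ∷ x ∷ μ)
  ≡⟨ cong₂ (λ D R → concatMap (component D) R) (μ₂-∷∷ x μ x<μ) (cong runs (nub-∷∷ x μ x<μ)) ⟩
    concatMap (component (x ∷ D)) (addToRuns x (runs (nub μ)))
  ≡⟨ cong (λ R → concatMap (component (x ∷ D)) (addToRuns x R)) re ⟩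
    concatMap (component (x ∷ D)) (addToRuns x ((suc x , n) ∷ rs))
  ≡⟨ cong (concatMap (component (x ∷ D))) (addToRuns-merge x n rs) ⟩
    sigComp x n (filterᵇ (inRun x n) (x ∷ D)) ++ concatMap (component (x ∷ D)) rs
  ≡⟨ cong₂ _++_ (cong (sigComp x n) (filterᵇ-accept _ x D (cong₂ _∧_ (≤⇒≤ᵇ≡true (≤-refl {x})) (≤⇒≤ᵇ≡true (<⇒≤ x<n)))))
                (components-∷-below x D rs x<rs) ⟩
    (x ∸ x + 1) ∷ sigTail n x (filterᵇ (inRun x n) D) ++ C
  ≡⟨ cong₂ (λ z F → (z + 1) ∷ sigTail n x F ++ C)
           (n∸n≡0 x) (inRun-suc x n D (All-filterᵇ (λ v → 2 ≤ᵇ count v μ) (All-nub μ x<μ))) ⟩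
    1 ∷ sigTail n x (filterᵇ (inRun (suc x) n) D) ++ C
  ≡⟨ cong (λ T → 1 ∷ T ++ C) (sigTail-extend x n _ x<n (inRun-≥ (suc x) n D)) ⟩
    1 ∷ mapHead (λ h → 2 + h) (sigComp (suc x) n (filterᵇ (inRun (suc x) n) D)) ++ C
  ≡⟨ cong (1 ∷_) (sym (mapHead-sigComp-++ (λ h → 2 + h) (suc x) n (filterᵇ (inRun (suc x) n) D) C)) ⟩
    1 ∷ mapHead (λ h → 2 + h) (concatMap (component D) ((suc x , n) ∷ rs))
  ≡⟨ cong (λ R → 1 ∷ mapHead (λ h → 2 + h) (concatMap (component D) R)) (sym re) ⟩
    1 ∷ mapHead (λ h → 2 + h) (SIG μ)
  ∎
  where
  open ≡-Reasoning
  μ = suc x ∷ μ′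
  D = μ₂ μ
  C = concatMap (component D) rs
  x<μ : All (x <_) μ
  x<μ = ≤-refl ∷ Sorted≥⇒All≤ s
  x<n : suc x ≤ n
  x<n = All.head (subst (All _) re (runs-ordered (nub μ)))
  x<rs : All (λ r → x < proj₁ r) rs
  x<rs = All.tail (subst (All _) re (runs-≥ (suc x) (nub μ) (All-nub μ (≤-refl ∷ Sorted≥⇒All≤ s))))

data Blocks : List ℕ → Set where
  []         : Blocks []
  isolated   : ∀ {x μ} → Sorted≥ (2 + x) μ → Blocks μ → Blocks (x ∷ μ)
  step       : ∀ {x μ} → Sorted≥ (suc x) μ → Blocks (suc x ∷ μ) → Blocks (x ∷ suc x ∷ μ)
  isolated²  : ∀ {x μ} → Sorted≥ (2 + x) μ → Blocks μ → Blocks (x ∷ x ∷ μ)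
  step²      : ∀ {x μ} → Sorted≥ (suc x) μ → Blocks (suc x ∷ μ) → Blocks (x ∷ x ∷ suc x ∷ μ)
  triple     : ∀ {x μ} → Blocks (x ∷ x ∷ x ∷ μ)

≤-cases : ∀ {x y} → x ≤ y → (y ≡ x) ⊎ (y ≡ suc x) ⊎ (2 + x ≤ y)
≤-cases {zero}  {zero}        _         = inj₁ refl
≤-cases {zero}  {suc zero}    _         = inj₂ (inj₁ refl)
≤-cases {zero}  {suc (suc y)} _         = inj₂ (inj₂ (s≤s (s≤s z≤n)))
≤-cases {suc x} {suc y}       (s≤s x≤y) with ≤-cases x≤y
... | inj₁ e        = inj₁ (cong suc e)
... | inj₂ (inj₁ e) = inj₂ (inj₁ (cong suc e))
... | inj₂ (inj₂ q) = inj₂ (inj₂ (s≤s q))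

Sorted≥-cases : ∀ {y μ} → Sorted≥ (suc y) μ →
                (Σ (List ℕ) λ μ′ → (μ ≡ suc y ∷ μ′) × Sorted≥ (suc y) μ′) ⊎ Sorted≥ (2 + y) μ
Sorted≥-cases [] = inj₂ []
Sorted≥-cases (_∷_ {xs = μ′} y<z s) with ≤-cases y<z
... | inj₁ refl        = inj₁ (μ′ , refl , s)
... | inj₂ (inj₁ refl) = inj₂ (≤-refl ∷ s)
... | inj₂ (inj₂ q)    = inj₂ (≤-trans (n≤1+n _) q ∷ s)

blocks : ∀ {p l} → Sorted≥ p l → Blocks l
blocks {l = l} = go (suc (length l)) ≤-refl
  where
  -- The recursive calls are on rebuilt proofs rather than subterms, hence the fuel.
  go : ∀ fuel {p l} → length l < fuel → Sorted≥ p l → Blocks l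
  go fuel _ [] = []
  go fuel {l = x ∷ []} _ (_ ∷ []) = isolated [] []
  go (suc fuel) {l = x ∷ y ∷ r} (s≤s |l|<fuel) (_ ∷ (x≤y ∷ sr)) with ≤-cases x≤y
  ... | inj₂ (inj₁ refl) = step sr (go fuel |l|<fuel (x≤y ∷ sr))
  ... | inj₂ (inj₂ q)    = isolated (q ∷ sr) (go fuel |l|<fuel (x≤y ∷ sr))
  ... | inj₁ refl with r | sr
  ...   | []     | []          = isolated² [] []
  ...   | z ∷ r′ | (x≤z ∷ sr′) with ≤-cases x≤z
  ...     | inj₁ refl        = triple
  ...     | inj₂ (inj₁ refl) = step² sr′ (go fuel (≤-trans (n≤1+n _) |l|<fuel) (x≤z ∷ sr′))
  ...     | inj₂ (inj₂ q)    = isolated² (q ∷ sr′) (go fuel (≤-trans (n≤1+n _) |l|<fuel) (x≤z ∷ sr′))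

-- Neighbours

∣n-1+n∣≡1 : ∀ x → ∣ x - suc x ∣ ≡ 1
∣n-1+n∣≡1 zero    = refl
∣n-1+n∣≡1 (suc x) = ∣n-1+n∣≡1 x

∣1+n-n∣≡1 : ∀ x → ∣ suc x - x ∣ ≡ 1
∣1+n-n∣≡1 zero    = refl
∣1+n-n∣≡1 (suc x) = ∣1+n-n∣≡1 x

Neighbours : (l : List ℕ) → Fin (length l) → Fin (length l) → Set
Neighbours l i j = ((toℕ i ≡ᵇ toℕ j) ≡ false) × ((∣ lookup l i - lookup l j ∣ ≤ᵇ 1) ≡ true)

-- Only the first part may lack a neighbour, and then SIG starts with 0.  Allowing this exception is
-- what makes the induction go through: in x ∷ suc x ∷ μ the first part of suc x ∷ μ gains the neighbour x.
NeighbourOrLeadingZero : List ℕ → Set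
NeighbourOrLeadingZero l =
  ∀ i → Σ (Fin (length l)) (Neighbours l i) ⊎ (toℕ i ≡ 0 × Σ (List ℕ) λ t → SIG l ≡ 0 ∷ t)

leadingZero-absurd : ∀ {xs t} → All (_≢ 0) xs → xs ≢ 0 ∷ t
leadingZero-absurd (x≢0 ∷ _) refl = x≢0 refl

drop1-mapHead : ∀ f xs → drop 1 (mapHead f xs) ≡ drop 1 xs
drop1-mapHead f []      = refl
drop1-mapHead f (_ ∷ _) = refl

tailNonZero : ∀ {xs S} → xs ≡ S → All (_≢ 0) (drop 1 xs) → All (_≢ 0) (drop 1 S)
tailNonZero eq = subst (λ z → All (_≢ 0) (drop 1 z)) eq

false≢true : false ≢ true
false≢true ()

neighbourOrLeadingZero : ∀ {l} → Blocks l → atMostTwiceᵇ l ≡ true → All (_≢ 0) (drop 1 (SIG l)) →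
                         NeighbourOrLeadingZero l
neighbourOrLeadingZero [] _ _ ()
neighbourOrLeadingZero (isolated {x} {μ} s b) _ _ Fin.zero = inj₂ (refl , SIG μ , SIG-isolated x μ s)
neighbourOrLeadingZero (isolated {x} {μ} s b) ok nz (Fin.suc i)
  with neighbourOrLeadingZero b (trans (sym (atMostTwiceᵇ-∷ x μ (Sorted≥⇒All> s))) ok)
                               (drop⁺ 1 (tailNonZero (SIG-isolated x μ s) nz)) i
... | inj₁ (j , close) = inj₁ (Fin.suc j , close)
... | inj₂ (_ , _ , e) = ⊥-elim (leadingZero-absurd (tailNonZero (SIG-isolated x μ s) nz) e)
neighbourOrLeadingZero (step {x} s b) _ _ Fin.zero = inj₁ (Fin.suc Fin.zero , refl , cong (_≤ᵇ 1) (∣n-1+n∣≡1 x))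
neighbourOrLeadingZero (step {x} {μ} s b) ok nz (Fin.suc i)
  with neighbourOrLeadingZero b (trans (sym (atMostTwiceᵇ-∷ x (suc x ∷ μ) (≤-refl ∷ Sorted≥⇒All≤ s))) ok)
         (subst (All (_≢ 0)) (drop1-mapHead suc (SIG (suc x ∷ μ))) (tailNonZero (SIG-extend x μ s) nz)) i
... | inj₁ (j , close) = inj₁ (Fin.suc j , close)
... | inj₂ (i≡0 , _) with i | i≡0
...   | Fin.zero | _ = inj₁ (Fin.zero , refl , cong (_≤ᵇ 1) (∣1+n-n∣≡1 x))
neighbourOrLeadingZero (isolated² {x} s b) _ _ Fin.zero = inj₁ (Fin.suc Fin.zero , refl , cong (_≤ᵇ 1) (∣n-n∣≡0 x))
neighbourOrLeadingZero (isolated² {x} s b) _ _ (Fin.suc Fin.zero) = inj₁ (Fin.zero , refl , cong (_≤ᵇ 1) (∣n-n∣≡0 x))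
neighbourOrLeadingZero (isolated² {x} {μ} s b) ok nz (Fin.suc (Fin.suc i))
  with neighbourOrLeadingZero b (trans (sym (atMostTwiceᵇ-∷∷ x μ (Sorted≥⇒All> s))) ok)
                               (drop⁺ 2 (tailNonZero (SIG-isolatedDouble x μ s) nz)) i
... | inj₁ (j , close) = inj₁ (Fin.suc (Fin.suc j) , close)
... | inj₂ (_ , _ , e) = ⊥-elim (leadingZero-absurd (drop⁺ 1 (tailNonZero (SIG-isolatedDouble x μ s) nz)) e)
neighbourOrLeadingZero (step² {x} s b) _ _ Fin.zero = inj₁ (Fin.suc Fin.zero , refl , cong (_≤ᵇ 1) (∣n-n∣≡0 x))
neighbourOrLeadingZero (step² {x} s b) _ _ (Fin.suc Fin.zero) = inj₁ (Fin.zero , refl , cong (_≤ᵇ 1) (∣n-n∣≡0 x))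
neighbourOrLeadingZero (step² {x} {μ} s b) ok nz (Fin.suc (Fin.suc i))
  with neighbourOrLeadingZero b (trans (sym (atMostTwiceᵇ-∷∷ x (suc x ∷ μ) (≤-refl ∷ Sorted≥⇒All≤ s))) ok)
         (subst (All (_≢ 0)) (drop1-mapHead (λ h → 2 + h) (SIG (suc x ∷ μ)))
                (drop⁺ 1 (tailNonZero (SIG-extendDouble x μ s) nz))) i
... | inj₁ (j , close) = inj₁ (Fin.suc (Fin.suc j) , close)
... | inj₂ (i≡0 , _) with i | i≡0
...   | Fin.zero | _ = inj₁ (Fin.suc Fin.zero , refl , cong (_≤ᵇ 1) (∣1+n-n∣≡1 x))
neighbourOrLeadingZero (triple {x} {μ}) ok _ _ = ⊥-elim (false≢true (trans (sym (atMostTwiceᵇ-triple x μ)) ok))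

all-tabulate : ∀ {A : Set} {n} (g : Fin n → A) (f : A → Bool) → (∀ i → f (g i) ≡ true) → all f (tabulate g) ≡ true
all-tabulate {n = zero}  g f all-i = refl
all-tabulate {n = suc n} g f all-i rewrite all-i Fin.zero = all-tabulate (g ∘ Fin.suc) f (all-i ∘ Fin.suc)

any-tabulate : ∀ {A : Set} {n} (g : Fin n → A) (f : A → Bool) j → f (g j) ≡ true → any f (tabulate g) ≡ true
any-tabulate g f Fin.zero fj rewrite fj = refl
any-tabulate {n = suc n} g f (Fin.suc j) fj rewrite any-tabulate (g ∘ Fin.suc) f j fj = ∨-zeroʳ (f (g Fin.zero))

hasNeighboursᵇ : List ℕ → Bool
hasNeighboursᵇ l = all (λ i → any (λ j → not (toℕ i ≡ᵇ toℕ j) ∧ (∣ lookup l i - lookup l j ∣ ≤ᵇ 1))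
                                  (allFin (length l)))
                       (allFin (length l))

hasNeighboursᵇ-true : ∀ {l} → Blocks l → atMostTwiceᵇ l ≡ true → All (_≢ 0) (SIG l) → hasNeighboursᵇ l ≡ true
hasNeighboursᵇ-true {l} b ok nz = all-tabulate id _ each
  where
  each : ∀ i → any (λ j → not (toℕ i ≡ᵇ toℕ j) ∧ (∣ lookup l i - lookup l j ∣ ≤ᵇ 1)) (allFin (length l)) ≡ true
  each i with neighbourOrLeadingZero b ok (drop⁺ 1 nz) i
  ... | inj₁ (j , i≢j , close) = any-tabulate id _ j (cong₂ _∧_ (cong not i≢j) close)
  ... | inj₂ (_ , _ , e)       = ⊥-elim (leadingZero-absurd nz e)

-- The weight

sigWeight : ℕ → ℤ
sigWeight x = if x % 3 ≡ᵇ 0 then + 0 else (if x % 3 ≡ᵇ 1 then -[1+ 0 ] else + 1)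

sigProduct : List ℕ → ℤ
sigProduct []       = + 1
sigProduct (x ∷ xs) = sigWeight x ℤ.* sigProduct xs

signedProduct : List ℕ → ℤ
signedProduct l = sigProduct (SIG l) ℤ.* negOnePow (length (μ₂ l))

weight : List ℕ → ℤ
weight l = if atMostTwiceᵇ l then signedProduct l else + 0

if-neg : ∀ (b : Bool) (x : ℤ) → (if b then ℤ.- x else + 0) ≡ ℤ.- (if b then x else + 0)
if-neg true  x = refl
if-neg false x = refl

sign-as-product : ∀ xs k →
  (if all (λ x → not (x % 3 ≡ᵇ 0)) xs then negOnePow (countᵇ (λ x → x % 3 ≡ᵇ 1) xs + k) else + 0)
    ≡ sigProduct xs ℤ.* negOnePow k
sign-as-product []       k = sym (ℤ.*-identityˡ _)
sign-as-product (x ∷ xs) k with x % 3 ≡ᵇ 0 | x % 3 ≡ᵇ 1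
... | true  | _     = refl
... | false | true  = begin
    (if all _ xs then ℤ.- negOnePow (countᵇ _ xs + k) else + 0)
  ≡⟨ if-neg (all _ xs) _ ⟩
    ℤ.- (if all _ xs then negOnePow (countᵇ _ xs + k) else + 0)
  ≡⟨ cong ℤ.-_ (sign-as-product xs k) ⟩
    ℤ.- (sigProduct xs ℤ.* negOnePow k)
  ≡⟨ ℤ.neg-distribˡ-* (sigProduct xs) (negOnePow k) ⟩
    ℤ.- sigProduct xs ℤ.* negOnePow k
  ≡⟨ cong (ℤ._* negOnePow k) (sym (ℤ.-1*i≡-i (sigProduct xs))) ⟩
    -[1+ 0 ] ℤ.* sigProduct xs ℤ.* negOnePow k
  ∎
  where open ≡-Reasoning
... | false | false = trans (sign-as-product xs k) (cong (ℤ._* negOnePow k) (sym (ℤ.*-identityˡ (sigProduct xs))))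

all-notMultipleOf3⇒≢0 : ∀ xs → all (λ x → not (x % 3 ≡ᵇ 0)) xs ≡ true → All (_≢ 0) xs
all-notMultipleOf3⇒≢0 []       _ = []
all-notMultipleOf3⇒≢0 (x ∷ xs) e with not (x % 3 ≡ᵇ 0) in eq
... | true = (λ { refl → false≢true eq }) ∷ all-notMultipleOf3⇒≢0 xs e

if-∧-implied : ∀ a b c (s t : ℤ) → (a ≡ true → c ≡ true → b ≡ true) → (if c then s else + 0) ≡ t →
               (if (a ∧ b) ∧ c then s else + 0) ≡ (if a then t else + 0)
if-∧-implied false b     c     s t _   _  = refl
if-∧-implied true  false false s t _   eq = eq
if-∧-implied true  true  false s t _   eq = eq
if-∧-implied true  false true  s t imp eq with imp refl refl
... | ()
if-∧-implied true  true  true  s t _   eq = eq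

admissible-sign≡weight : ∀ {p l} → Sorted≥ p l → when admissibleᵇ sign l ≡ weight l
admissible-sign≡weight {l = l} s =
  if-∧-implied (atMostTwiceᵇ l) (hasNeighboursᵇ l) (all _ (SIG l)) (sign l) _
    (λ twice ok → hasNeighboursᵇ-true (blocks s) twice (all-notMultipleOf3⇒≢0 (SIG l) ok))
    (sign-as-product (SIG l) (length (μ₂ l)))

weight-cong : ∀ l μ (σ : ℤ) → atMostTwiceᵇ l ≡ atMostTwiceᵇ μ →
              (atMostTwiceᵇ μ ≡ true → signedProduct l ≡ σ ℤ.* signedProduct μ) → weight l ≡ σ ℤ.* weight μ
weight-cong l μ σ twice≡ product≡ rewrite twice≡ with atMostTwiceᵇ μ
... | true  = product≡ refl
... | false = sym (ℤ.*-zeroʳ σ)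

weight-zero : ∀ l → atMostTwiceᵇ l ≡ false ⊎ sigProduct (SIG l) ≡ + 0 → weight l ≡ + 0
weight-zero l (inj₁ e) rewrite e = refl
weight-zero l (inj₂ e) with atMostTwiceᵇ l
... | true  = cong (ℤ._* negOnePow (length (μ₂ l))) e
... | false = refl

sigProduct-++ : ∀ xs ys → sigProduct (xs ++ ys) ≡ sigProduct xs ℤ.* sigProduct ys
sigProduct-++ []       ys = sym (ℤ.*-identityˡ _)
sigProduct-++ (x ∷ xs) ys = trans (cong (sigWeight x ℤ.*_) (sigProduct-++ xs ys)) (sym (ℤ.*-assoc (sigWeight x) _ _))

negOnePow-+ : ∀ d k → negOnePow (d + k) ≡ negOnePow d ℤ.* negOnePow k
negOnePow-+ zero    k = sym (ℤ.*-identityˡ _)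
negOnePow-+ (suc d) k = trans (cong ℤ.-_ (negOnePow-+ d k)) (ℤ.neg-distribˡ-* (negOnePow d) (negOnePow k))

weight-prefix : ∀ l μ pre S d → atMostTwiceᵇ l ≡ atMostTwiceᵇ μ → SIG l ≡ pre ++ S →
                sigProduct S ≡ sigProduct (SIG μ) → length (μ₂ l) ≡ d + length (μ₂ μ) →
                weight l ≡ (sigProduct pre ℤ.* negOnePow d) ℤ.* weight μ
weight-prefix l μ pre S d twice≡ SIG≡ product≡ length≡ =
  weight-cong l μ (sigProduct pre ℤ.* negOnePow d) twice≡ λ _ → begin
    sigProduct (SIG l) ℤ.* negOnePow (length (μ₂ l))
  ≡⟨ cong₂ (λ T k → sigProduct T ℤ.* negOnePow k) SIG≡ length≡ ⟩
    sigProduct (pre ++ S) ℤ.* negOnePow (d + length (μ₂ μ))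
  ≡⟨ cong₂ ℤ._*_ (trans (sigProduct-++ pre S) (cong (sigProduct pre ℤ.*_) product≡)) (negOnePow-+ d _) ⟩
    (sigProduct pre ℤ.* sigProduct (SIG μ)) ℤ.* (negOnePow d ℤ.* negOnePow (length (μ₂ μ)))
  ≡⟨ interchange (sigProduct pre) (sigProduct (SIG μ)) (negOnePow d) (negOnePow (length (μ₂ μ))) ⟩
    (sigProduct pre ℤ.* negOnePow d) ℤ.* signedProduct μ
  ∎
  where open ≡-Reasoning

mapHead-∘ : ∀ f g xs → mapHead f (mapHead g xs) ≡ mapHead (f ∘ g) xs
mapHead-∘ f g []      = refl
mapHead-∘ f g (_ ∷ _) = refl

sigProduct-mapHead-3+ : ∀ xs → sigProduct (mapHead (λ h → 3 + h) xs) ≡ sigProduct xs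
sigProduct-mapHead-3+ []       = refl
sigProduct-mapHead-3+ (h ∷ xs) =
  cong (λ r → (if r ≡ᵇ 0 then + 0 else (if r ≡ᵇ 1 then -[1+ 0 ] else + 1)) ℤ.* sigProduct xs)
       (trans (cong (_% 3) (+-comm 3 h)) ([m+n]%n≡m%n h 3))

-- Whether x joins the run starting μ or stands alone, raising the first entry of SIG (x ∷ μ) by 2
-- leaves a factor of weight 1.
sigProduct-2+SIG : ∀ x μ → Sorted≥ (suc x) μ → sigProduct (mapHead (λ h → 2 + h) (SIG (x ∷ μ))) ≡ sigProduct (SIG μ)
sigProduct-2+SIG x μ s with Sorted≥-cases s
... | inj₁ (μ′ , refl , s′) =
  trans (cong (sigProduct ∘ mapHead (λ h → 2 + h)) (SIG-extend x μ′ s′))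
        (trans (cong sigProduct (mapHead-∘ (λ h → 2 + h) suc (SIG μ))) (sigProduct-mapHead-3+ (SIG μ)))
... | inj₂ s₂ = trans (cong (sigProduct ∘ mapHead (λ h → 2 + h)) (SIG-isolated x μ s₂)) (ℤ.*-identityˡ _)

SIG-double : ∀ y μ → Sorted≥ y μ →
             atMostTwiceᵇ (y ∷ y ∷ μ) ≡ false ⊎ Σ (List ℕ) λ X → SIG (y ∷ y ∷ μ) ≡ 1 ∷ X
SIG-double y []      []        = inj₂ (_ , SIG-isolatedDouble y [] [])
SIG-double y (z ∷ r) (y≤z ∷ s) with ≤-cases y≤z
... | inj₁ refl        = inj₁ (atMostTwiceᵇ-triple y r)
... | inj₂ (inj₁ refl) = inj₂ (_ , SIG-extendDouble y r s)
... | inj₂ (inj₂ q)    = inj₂ (_ , SIG-isolatedDouble y (z ∷ r) (q ∷ s))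

-- In the names below a, b, c stand for three consecutive values p, suc p, 2 + p.

weight-aaa : ∀ p μ → weight (p ∷ p ∷ p ∷ μ) ≡ + 0
weight-aaa p μ = weight-zero (p ∷ p ∷ p ∷ μ) (inj₁ (atMostTwiceᵇ-triple p μ))

weight-a : ∀ p μ → Sorted≥ (2 + p) μ → weight (p ∷ μ) ≡ + 0
weight-a p μ s = weight-zero (p ∷ μ) (inj₂ (cong sigProduct (SIG-isolated p μ s)))

weight-aa : ∀ p μ → Sorted≥ (2 + p) μ → weight (p ∷ p ∷ μ) ≡ ℤ.- weight μ
weight-aa p μ s = trans
  (weight-prefix (p ∷ p ∷ μ) μ (1 ∷ 1 ∷ []) (SIG μ) 1
     (atMostTwiceᵇ-∷∷ p μ p<μ) (SIG-isolatedDouble p μ s) refl (cong length (μ₂-∷∷ p μ p<μ)))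
  (ℤ.-1*i≡-i _)
  where p<μ = Sorted≥⇒All> s

weight-ab : ∀ p μ → Sorted≥ (3 + p) μ → weight (p ∷ suc p ∷ μ) ≡ ℤ.- weight μ
weight-ab p μ s = trans
  (weight-prefix (p ∷ suc p ∷ μ) μ (1 ∷ []) (SIG μ) 0
     (trans (atMostTwiceᵇ-∷ p _ p<bμ) (atMostTwiceᵇ-∷ (suc p) μ b<μ))
     (trans (SIG-extend p μ (Sorted≥-weaken (≤-trans (n≤1+n _) (n≤1+n _)) s))
            (cong (mapHead suc) (SIG-isolated (suc p) μ s)))
     refl
     (trans (cong length (μ₂-∷ p _ p<bμ)) (cong length (μ₂-∷ (suc p) μ b<μ))))
  (ℤ.-1*i≡-i _)
  where
  b<μ = Sorted≥⇒All> s
  p<bμ = ≤-refl ∷ All.map (≤-trans (n≤1+n _)) b<μ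

weight-aab : ∀ p μ → Sorted≥ (2 + p) μ → weight (p ∷ p ∷ suc p ∷ μ) ≡ weight μ
weight-aab p μ s = trans
  (weight-prefix (p ∷ p ∷ suc p ∷ μ) μ (1 ∷ []) (mapHead (λ h → 2 + h) (SIG (suc p ∷ μ))) 1
     (trans (atMostTwiceᵇ-∷∷ p _ (≤-refl ∷ Sorted≥⇒All> s)) (atMostTwiceᵇ-∷ (suc p) μ (Sorted≥⇒All≤ s)))
     (SIG-extendDouble p μ (Sorted≥-weaken (n≤1+n _) s))
     (sigProduct-2+SIG (suc p) μ s)
     (trans (cong length (μ₂-∷∷ p _ (≤-refl ∷ Sorted≥⇒All> s))) (cong (suc ∘ length) (μ₂-∷ (suc p) μ (Sorted≥⇒All≤ s)))))
  (ℤ.*-identityˡ _)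

weight-abb : ∀ p μ → Sorted≥ (3 + p) μ → weight (p ∷ suc p ∷ suc p ∷ μ) ≡ weight μ
weight-abb p μ s = trans
  (weight-prefix (p ∷ suc p ∷ suc p ∷ μ) μ (2 ∷ 1 ∷ []) (SIG μ) 1
     (trans (atMostTwiceᵇ-∷ p _ p<bbμ) (atMostTwiceᵇ-∷∷ (suc p) μ b<μ))
     (trans (SIG-extend p (suc p ∷ μ) (≤-refl ∷ Sorted≥-weaken (≤-trans (n≤1+n _) (n≤1+n _)) s))
            (cong (mapHead suc) (SIG-isolatedDouble (suc p) μ s)))
     refl
     (trans (cong length (μ₂-∷ p _ p<bbμ)) (cong length (μ₂-∷∷ (suc p) μ b<μ))))
  (ℤ.*-identityˡ _)
  where
  b<μ = Sorted≥⇒All> s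
  p<bbμ = ≤-refl ∷ ≤-refl ∷ All.map (≤-trans (n≤1+n _)) b<μ

weight-abc : ∀ p μ → Sorted≥ (3 + p) μ → weight (p ∷ suc p ∷ 2 + p ∷ μ) ≡ weight μ
weight-abc p μ s = trans
  (weight-prefix (p ∷ suc p ∷ 2 + p ∷ μ) μ [] (mapHead (λ h → 2 + h) (SIG (2 + p ∷ μ))) 0
     (trans (atMostTwiceᵇ-∷ p _ (≤-refl ∷ n≤1+n _ ∷ All.map (≤-trans (n≤1+n _)) c≤μ))
            (trans (atMostTwiceᵇ-∷ (suc p) _ (≤-refl ∷ c≤μ)) (atMostTwiceᵇ-∷ (2 + p) μ (Sorted≥⇒All≤ s))))
     (trans (SIG-extend p (2 + p ∷ μ) (n≤1+n _ ∷ Sorted≥-weaken (n≤1+n _) s))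
            (trans (cong (mapHead suc) (SIG-extend (suc p) μ (Sorted≥-weaken (n≤1+n _) s)))
                   (mapHead-∘ suc suc (SIG (2 + p ∷ μ)))))
     (sigProduct-2+SIG (2 + p) μ s)
     (trans (cong length (μ₂-∷ p _ (≤-refl ∷ n≤1+n _ ∷ All.map (≤-trans (n≤1+n _)) c≤μ)))
            (trans (cong length (μ₂-∷ (suc p) _ (≤-refl ∷ c≤μ))) (cong length (μ₂-∷ (2 + p) μ (Sorted≥⇒All≤ s))))))
  (ℤ.*-identityˡ _)
  where c≤μ = Sorted≥⇒All> s

weight-abbc : ∀ p μ → Sorted≥ (3 + p) μ → weight (p ∷ suc p ∷ suc p ∷ 2 + p ∷ μ) ≡ ℤ.- weight μ
weight-abbc p μ s = trans
  (weight-prefix (p ∷ suc p ∷ suc p ∷ 2 + p ∷ μ) μ (2 ∷ []) (mapHead (λ h → 2 + h) (SIG (2 + p ∷ μ))) 1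
     (trans (atMostTwiceᵇ-∷ p _ (≤-refl ∷ ≤-refl ∷ n≤1+n _ ∷ All.map (≤-trans (n≤1+n _)) c≤μ))
            (trans (atMostTwiceᵇ-∷∷ (suc p) _ (≤-refl ∷ c≤μ)) (atMostTwiceᵇ-∷ (2 + p) μ (Sorted≥⇒All≤ s))))
     (trans (SIG-extend p (suc p ∷ 2 + p ∷ μ) (≤-refl ∷ n≤1+n _ ∷ Sorted≥-weaken (n≤1+n _) s))
            (cong (mapHead suc) (SIG-extendDouble (suc p) μ (Sorted≥-weaken (n≤1+n _) s))))
     (sigProduct-2+SIG (2 + p) μ s)
     (trans (cong length (μ₂-∷ p _ (≤-refl ∷ ≤-refl ∷ n≤1+n _ ∷ All.map (≤-trans (n≤1+n _)) c≤μ)))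
            (trans (cong length (μ₂-∷∷ (suc p) _ (≤-refl ∷ c≤μ)))
                   (cong (suc ∘ length) (μ₂-∷ (2 + p) μ (Sorted≥⇒All≤ s))))))
  (ℤ.-1*i≡-i _)
  where c≤μ = Sorted≥⇒All> s

weight-abbb : ∀ p μ → Sorted≥ (suc p) μ → weight (p ∷ suc p ∷ suc p ∷ suc p ∷ μ) ≡ + 0
weight-abbb p μ s = weight-zero (p ∷ suc p ∷ suc p ∷ suc p ∷ μ) (inj₁
  (trans (atMostTwiceᵇ-∷ p _ (≤-refl ∷ ≤-refl ∷ ≤-refl ∷ Sorted≥⇒All≤ s)) (atMostTwiceᵇ-triple (suc p) μ)))

-- When SIG does not vanish through a triple, the second double makes a SIG entry 3.
weight-aabb : ∀ p μ → Sorted≥ (suc p) μ → weight (p ∷ p ∷ suc p ∷ suc p ∷ μ) ≡ + 0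
weight-aabb p μ s with SIG-double (suc p) μ s
... | inj₁ bbb = weight-zero (p ∷ p ∷ suc p ∷ suc p ∷ μ) (inj₁
  (trans (atMostTwiceᵇ-∷∷ p _ (≤-refl ∷ ≤-refl ∷ Sorted≥⇒All≤ s)) bbb))
... | inj₂ (X , e) = weight-zero (p ∷ p ∷ suc p ∷ suc p ∷ μ) (inj₂ (cong sigProduct
  (trans (SIG-extendDouble p (suc p ∷ μ) (≤-refl ∷ s)) (cong (λ z → 1 ∷ mapHead (λ h → 2 + h) z) e))))

weight-abcc : ∀ p μ → Sorted≥ (2 + p) μ → weight (p ∷ suc p ∷ 2 + p ∷ 2 + p ∷ μ) ≡ + 0
weight-abcc p μ s with SIG-double (2 + p) μ s
... | inj₁ bbb = weight-zero (p ∷ suc p ∷ 2 + p ∷ 2 + p ∷ μ) (inj₁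
  (trans (atMostTwiceᵇ-∷ p _ (≤-refl ∷ n≤1+n _ ∷ n≤1+n _ ∷ Sorted≥⇒All> s))
         (trans (atMostTwiceᵇ-∷ (suc p) _ (≤-refl ∷ ≤-refl ∷ Sorted≥⇒All≤ s)) bbb)))
... | inj₂ (X , e) = weight-zero (p ∷ suc p ∷ 2 + p ∷ 2 + p ∷ μ) (inj₂ (cong sigProduct
  (trans (SIG-extend p (2 + p ∷ 2 + p ∷ μ) (n≤1+n _ ∷ ≤-refl ∷ s))
         (cong (mapHead suc) (trans (SIG-extend (suc p) (2 + p ∷ μ) (≤-refl ∷ s)) (cong (mapHead suc) e))))))

weight-abbcc : ∀ p μ → Sorted≥ (2 + p) μ → weight (p ∷ suc p ∷ suc p ∷ 2 + p ∷ 2 + p ∷ μ) ≡ + 0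
weight-abbcc p μ s with SIG-double (2 + p) μ s
... | inj₁ bbb = weight-zero (p ∷ suc p ∷ suc p ∷ 2 + p ∷ 2 + p ∷ μ) (inj₁
  (trans (atMostTwiceᵇ-∷ p _ (≤-refl ∷ ≤-refl ∷ n≤1+n _ ∷ n≤1+n _ ∷ Sorted≥⇒All> s))
         (trans (atMostTwiceᵇ-∷∷ (suc p) _ (≤-refl ∷ ≤-refl ∷ Sorted≥⇒All≤ s)) bbb)))
... | inj₂ (X , e) = weight-zero (p ∷ suc p ∷ suc p ∷ 2 + p ∷ 2 + p ∷ μ) (inj₂ (cong sigProduct
  (trans (SIG-extend p (suc p ∷ 2 + p ∷ 2 + p ∷ μ) (≤-refl ∷ n≤1+n _ ∷ ≤-refl ∷ s))
         (cong (mapHead suc) (trans (SIG-extendDouble (suc p) (2 + p ∷ μ) (≤-refl ∷ s))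
                                    (cong (λ z → 1 ∷ mapHead (λ h → 2 + h) z) e))))))

Sorted≥-map-suc : ∀ {b l} → Sorted≥ b l → Sorted≥ (suc b) (map suc l)
Sorted≥-map-suc []          = []
Sorted≥-map-suc (b≤x ∷ sxs) = s≤s b≤x ∷ Sorted≥-map-suc sxs

ShiftInvariant : List ℕ → Set
ShiftInvariant l = atMostTwiceᵇ (map suc l) ≡ atMostTwiceᵇ l ×
  (atMostTwiceᵇ l ≡ true → SIG (map suc l) ≡ SIG l × length (μ₂ (map suc l)) ≡ length (μ₂ l))

shiftInvariant-∷ : ∀ {l μ} (F : List ℕ → List ℕ) δ →
  atMostTwiceᵇ (map suc l) ≡ atMostTwiceᵇ (map suc μ) → atMostTwiceᵇ l ≡ atMostTwiceᵇ μ →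
  SIG (map suc l) ≡ F (SIG (map suc μ)) → SIG l ≡ F (SIG μ) →
  length (μ₂ (map suc l)) ≡ δ + length (μ₂ (map suc μ)) → length (μ₂ l) ≡ δ + length (μ₂ μ) →
  ShiftInvariant μ → ShiftInvariant l
shiftInvariant-∷ F δ twice′ twice SIG′ SIG≡ len′ len (twice≡ , rest≡) =
  trans twice′ (trans twice≡ (sym twice)) , λ ok →
  let SIG≡′ , len≡ = rest≡ (trans (sym twice) ok) in
  trans SIG′ (trans (cong F SIG≡′) (sym SIG≡)) , trans len′ (trans (cong (λ k → δ + k) len≡) (sym len))

shiftInvariant : ∀ {l} → Blocks l → ShiftInvariant l
shiftInvariant [] = refl , λ _ → refl , refl
shiftInvariant (isolated {x} {μ} s b) = shiftInvariant-∷ {x ∷ μ} {μ} (0 ∷_) 0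
  (atMostTwiceᵇ-∷ (suc x) _ (Sorted≥⇒All> s′)) (atMostTwiceᵇ-∷ x μ (Sorted≥⇒All> s))
  (SIG-isolated (suc x) _ s′) (SIG-isolated x μ s)
  (cong length (μ₂-∷ (suc x) _ (Sorted≥⇒All> s′))) (cong length (μ₂-∷ x μ (Sorted≥⇒All> s)))
  (shiftInvariant b)
  where s′ = Sorted≥-map-suc s
shiftInvariant (step {x} {μ} s b) = shiftInvariant-∷ {x ∷ suc x ∷ μ} {suc x ∷ μ} (mapHead suc) 0
  (atMostTwiceᵇ-∷ (suc x) _ (≤-refl ∷ Sorted≥⇒All≤ s′)) (atMostTwiceᵇ-∷ x _ (≤-refl ∷ Sorted≥⇒All≤ s))
  (SIG-extend (suc x) _ s′) (SIG-extend x μ s)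
  (cong length (μ₂-∷ (suc x) _ (≤-refl ∷ Sorted≥⇒All≤ s′))) (cong length (μ₂-∷ x _ (≤-refl ∷ Sorted≥⇒All≤ s)))
  (shiftInvariant b)
  where s′ = Sorted≥-map-suc s
shiftInvariant (isolated² {x} {μ} s b) = shiftInvariant-∷ {x ∷ x ∷ μ} {μ} (λ S → 1 ∷ 1 ∷ S) 1
  (atMostTwiceᵇ-∷∷ (suc x) _ (Sorted≥⇒All> s′)) (atMostTwiceᵇ-∷∷ x μ (Sorted≥⇒All> s))
  (SIG-isolatedDouble (suc x) _ s′) (SIG-isolatedDouble x μ s)
  (cong length (μ₂-∷∷ (suc x) _ (Sorted≥⇒All> s′))) (cong length (μ₂-∷∷ x μ (Sorted≥⇒All> s)))
  (shiftInvariant b)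
  where s′ = Sorted≥-map-suc s
shiftInvariant (step² {x} {μ} s b) =
  shiftInvariant-∷ {x ∷ x ∷ suc x ∷ μ} {suc x ∷ μ} (λ S → 1 ∷ mapHead (λ h → 2 + h) S) 1
  (atMostTwiceᵇ-∷∷ (suc x) _ (≤-refl ∷ Sorted≥⇒All≤ s′)) (atMostTwiceᵇ-∷∷ x _ (≤-refl ∷ Sorted≥⇒All≤ s))
  (SIG-extendDouble (suc x) _ s′) (SIG-extendDouble x μ s)
  (cong length (μ₂-∷∷ (suc x) _ (≤-refl ∷ Sorted≥⇒All≤ s′))) (cong length (μ₂-∷∷ x _ (≤-refl ∷ Sorted≥⇒All≤ s)))
  (shiftInvariant b)
  where s′ = Sorted≥-map-suc s
shiftInvariant (triple {x} {μ}) =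
  trans (atMostTwiceᵇ-triple (suc x) (map suc μ)) (sym (atMostTwiceᵇ-triple x μ)) ,
  λ ok → ⊥-elim (false≢true (trans (sym (atMostTwiceᵇ-triple x μ)) ok))

weight-map-suc : ∀ {p l} → Sorted≥ p l → weight (map suc l) ≡ weight l
weight-map-suc {l = l} s with shiftInvariant (blocks s)
... | twice≡ , rest≡ = trans
  (weight-cong (map suc l) l (+ 1) twice≡ λ ok → let SIG≡ , len≡ = rest≡ ok in
     trans (cong₂ (λ S k → sigProduct S ℤ.* negOnePow k) SIG≡ len≡) (sym (ℤ.*-identityˡ _)))
  (ℤ.*-identityˡ _)

-- Partitions with a given beginning

-- Extending ΣSorted by 0 to negative lengths makes the splitting identity hold for every length.
ΣSortedℤ : ℤ → ℕ → (List ℕ → ℤ) → Series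
ΣSortedℤ (+ n)    p f = ΣSorted n p f
ΣSortedℤ -[1+ _ ] p f = 0ˢ

ΣSortedℤ-split : ∀ k p (f : List ℕ → ℤ) →
                 ΣSortedℤ k p f ≗ q^ p · ΣSortedℤ (k - + 1) p (f ∘ (p ∷_)) ⊕ ΣSortedℤ k (suc p) f
ΣSortedℤ-split (+ zero)  p f m = sym (trans (cong (ℤ._+ ΣSorted zero (suc p) f m) (q^-0ˢ p m)) (ℤ.+-identityˡ _))
ΣSortedℤ-split (+ suc n) p f m = ΣSorted-split n p f m
ΣSortedℤ-split -[1+ n ]  p f m = sym (cong (ℤ._+ + 0) (q^-0ˢ p m))

ΣSortedℤ-cong : ∀ k p {f g : List ℕ → ℤ} → (∀ l → Sorted≥ p l → f l ≡ g l) → ΣSortedℤ k p f ≗ ΣSortedℤ k p g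
ΣSortedℤ-cong (+ n)    p eq = ΣSorted-cong n p eq
ΣSortedℤ-cong -[1+ _ ] p eq m = refl

ΣSortedℤ-zero : ∀ k p {f : List ℕ → ℤ} → (∀ l → Sorted≥ p l → f l ≡ + 0) → ΣSortedℤ k p f ≗ 0ˢ
ΣSortedℤ-zero (+ n)    p eq = ΣSorted-zero n p eq
ΣSortedℤ-zero -[1+ _ ] p eq m = refl

ΣSortedℤ-neg : ∀ k p (f : List ℕ → ℤ) → ΣSortedℤ k p (λ l → ℤ.- f l) ≗ ⊝ ΣSortedℤ k p f
ΣSortedℤ-neg (+ n)    p f = ΣSorted-neg n p f
ΣSortedℤ-neg -[1+ _ ] p f m = refl

ΣSortedℤ-shift : ∀ k p (f : List ℕ → ℤ) → ΣSortedℤ k (suc p) f ≗ q^ ℤ.∣ k ∣ · ΣSortedℤ k p (f ∘ map suc)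
ΣSortedℤ-shift (+ n)     p f = ΣSorted-shift n p f
ΣSortedℤ-shift -[1+ n ] p f m = sym (q^-0ˢ (suc n) m)

withPrefix : List ℕ → ℤ → ℕ → Series
withPrefix pre j b = ΣSortedℤ j b (λ l → weight (pre ++ l))

GF≗withPrefix : ∀ k → GF k ≗ withPrefix [] k 1
GF≗withPrefix (+ n)    m = trans (GFcoeff≗ΣSorted n m) (ΣSorted-cong n 1 (λ l s → admissible-sign≡weight s) m)
GF≗withPrefix -[1+ _ ] m = refl

withPrefix-shift : ∀ k b → withPrefix [] k (suc b) ≗ q^ ℤ.∣ k ∣ · withPrefix [] k b
withPrefix-shift k b m =
  trans (ΣSortedℤ-shift k b weight m) (q^-cong ℤ.∣ k ∣ (ΣSortedℤ-cong k b (λ l s → weight-map-suc s)) m)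

withPrefix≗q^GF : ∀ d k → withPrefix [] k (suc d) ≗ q^ (d * ℤ.∣ k ∣) · GF k
withPrefix≗q^GF zero    k m = sym (GF≗withPrefix k m)
withPrefix≗q^GF (suc d) k m = trans (withPrefix-shift k (suc d) m)
  (trans (q^-cong ℤ.∣ k ∣ (withPrefix≗q^GF d k) m) (q^-q^ ℤ.∣ k ∣ (d * ℤ.∣ k ∣) (GF k) m))

withPrefix-split : ∀ pre j b →
  withPrefix pre j b ≗ q^ b · withPrefix (pre ++ b ∷ []) (j - + 1) b ⊕ withPrefix pre j (suc b)
withPrefix-split pre j b m = trans (ΣSortedℤ-split j b _ m)
  (cong (ℤ._+ withPrefix pre j (suc b) m)
        (q^-cong b (ΣSortedℤ-cong (j - + 1) b (λ l _ → cong weight (sym (List.++-assoc pre (b ∷ []) l)))) m))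

withPrefix-skip : ∀ pre j b → (∀ l → Sorted≥ b l → weight (pre ++ b ∷ l) ≡ + 0) →
                  withPrefix pre j b ≗ withPrefix pre j (suc b)
withPrefix-skip pre j b vanish m = trans (withPrefix-split pre j b m) (trans
  (cong (ℤ._+ withPrefix pre j (suc b) m)
        (trans (q^-cong b (ΣSortedℤ-zero (j - + 1) b λ l s → trans (cong weight (List.++-assoc pre (b ∷ []) l)) (vanish l s)) m)
               (q^-0ˢ b m)))
  (ℤ.+-identityˡ _))

withPrefix-stop : ∀ pre j b → (∀ l → Sorted≥ (suc b) l → weight (pre ++ l) ≡ + 0) →
                  withPrefix pre j b ≗ q^ b · withPrefix (pre ++ b ∷ []) (j - + 1) b
withPrefix-stop pre j b vanish m = trans (withPrefix-split pre j b m) (trans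
  (cong (λ z → (q^ b · withPrefix (pre ++ b ∷ []) (j - + 1) b) m ℤ.+ z) (ΣSortedℤ-zero j (suc b) vanish m))
  (ℤ.+-identityʳ _))

withPrefix-≗ : ∀ pre j b → (∀ l → Sorted≥ b l → weight (pre ++ l) ≡ weight l) →
               withPrefix pre j b ≗ withPrefix [] j b
withPrefix-≗ pre j b eq = ΣSortedℤ-cong j b eq

withPrefix-≗⊝ : ∀ pre j b → (∀ l → Sorted≥ b l → weight (pre ++ l) ≡ ℤ.- weight l) →
                withPrefix pre j b ≗ ⊝ withPrefix [] j b
withPrefix-≗⊝ pre j b eq m = trans (ΣSortedℤ-cong j b eq m) (ΣSortedℤ-neg j b weight m)

withPrefix-aa : ∀ p j → withPrefix (p ∷ p ∷ []) j p ≗ q^ suc p · withPrefix [] (j - + 1) (2 + p) ⊕ ⊝ withPrefix [] j (2 + p)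
withPrefix-aa p j = begin
    withPrefix (p ∷ p ∷ []) j p
  ≈⟨ withPrefix-skip (p ∷ p ∷ []) j p (λ l _ → weight-aaa p l) ⟩
    withPrefix (p ∷ p ∷ []) j (suc p)
  ≈⟨ withPrefix-split (p ∷ p ∷ []) j (suc p) ⟩
    q^ suc p · withPrefix (p ∷ p ∷ suc p ∷ []) (j - + 1) (suc p) ⊕ withPrefix (p ∷ p ∷ []) j (2 + p)
  ≈⟨ ⊕-cong (q^-cong (suc p) aab) (withPrefix-≗⊝ (p ∷ p ∷ []) j (2 + p) (weight-aa p)) ⟩
    q^ suc p · withPrefix [] (j - + 1) (2 + p) ⊕ ⊝ withPrefix [] j (2 + p)
  ∎
  where
  open SetoidReasoning (ℕ →-setoid ℤ)
  aab : withPrefix (p ∷ p ∷ suc p ∷ []) (j - + 1) (suc p) ≗ withPrefix [] (j - + 1) (2 + p)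
  aab = begin
      withPrefix (p ∷ p ∷ suc p ∷ []) (j - + 1) (suc p)
    ≈⟨ withPrefix-skip (p ∷ p ∷ suc p ∷ []) (j - + 1) (suc p) (weight-aabb p) ⟩
      withPrefix (p ∷ p ∷ suc p ∷ []) (j - + 1) (2 + p)
    ≈⟨ withPrefix-≗ (p ∷ p ∷ suc p ∷ []) (j - + 1) (2 + p) (weight-aab p) ⟩
      withPrefix [] (j - + 1) (2 + p)
    ∎

withPrefix-abb : ∀ p j → withPrefix (p ∷ suc p ∷ suc p ∷ []) j (suc p) ≗
                    q^ (2 + p) · ⊝ withPrefix [] (j - + 1) (3 + p) ⊕ withPrefix [] j (3 + p)
withPrefix-abb p j = begin
    withPrefix abb j (suc p)
  ≈⟨ withPrefix-skip abb j (suc p) (weight-abbb p) ⟩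
    withPrefix abb j (2 + p)
  ≈⟨ withPrefix-split abb j (2 + p) ⟩
    q^ (2 + p) · withPrefix (abb ++ 2 + p ∷ []) (j - + 1) (2 + p) ⊕ withPrefix abb j (3 + p)
  ≈⟨ ⊕-cong (q^-cong (2 + p) abbc) (withPrefix-≗ abb j (3 + p) (weight-abb p)) ⟩
    q^ (2 + p) · ⊝ withPrefix [] (j - + 1) (3 + p) ⊕ withPrefix [] j (3 + p)
  ∎
  where
  open SetoidReasoning (ℕ →-setoid ℤ)
  abb = p ∷ suc p ∷ suc p ∷ []
  abbc : withPrefix (abb ++ 2 + p ∷ []) (j - + 1) (2 + p) ≗ ⊝ withPrefix [] (j - + 1) (3 + p)
  abbc = begin
      withPrefix (abb ++ 2 + p ∷ []) (j - + 1) (2 + p)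
    ≈⟨ withPrefix-skip (abb ++ 2 + p ∷ []) (j - + 1) (2 + p) (weight-abbcc p) ⟩
      withPrefix (abb ++ 2 + p ∷ []) (j - + 1) (3 + p)
    ≈⟨ withPrefix-≗⊝ (abb ++ 2 + p ∷ []) (j - + 1) (3 + p) (weight-abbc p) ⟩
      ⊝ withPrefix [] (j - + 1) (3 + p)
    ∎

withPrefix-abc : ∀ p j → withPrefix (p ∷ suc p ∷ 2 + p ∷ []) j (2 + p) ≗ withPrefix [] j (3 + p)
withPrefix-abc p j m = trans (withPrefix-skip (p ∷ suc p ∷ 2 + p ∷ []) j (2 + p) (weight-abcc p) m)
                        (withPrefix-≗ (p ∷ suc p ∷ 2 + p ∷ []) j (3 + p) (weight-abc p) m)

withPrefix-ab : ∀ p j → withPrefix (p ∷ suc p ∷ []) j (suc p) ≗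
  q^ suc p · (q^ (2 + p) · ⊝ withPrefix [] (j - + 1 - + 1) (3 + p) ⊕ withPrefix [] (j - + 1) (3 + p))
  ⊕ (q^ (2 + p) · withPrefix [] (j - + 1) (3 + p) ⊕ ⊝ withPrefix [] j (3 + p))
withPrefix-ab p j = begin
    withPrefix ab j (suc p)
  ≈⟨ withPrefix-split ab j (suc p) ⟩
    q^ suc p · withPrefix (p ∷ suc p ∷ suc p ∷ []) (j - + 1) (suc p) ⊕ withPrefix ab j (2 + p)
  ≈⟨ ⊕-cong (q^-cong (suc p) (withPrefix-abb p (j - + 1))) (λ m →
       trans (withPrefix-split ab j (2 + p) m)
             (⊕-cong (q^-cong (2 + p) (withPrefix-abc p (j - + 1))) (withPrefix-≗⊝ ab j (3 + p) (weight-ab p)) m)) ⟩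
    q^ suc p · (q^ (2 + p) · ⊝ withPrefix [] (j - + 1 - + 1) (3 + p) ⊕ withPrefix [] (j - + 1) (3 + p))
    ⊕ (q^ (2 + p) · withPrefix [] (j - + 1) (3 + p) ⊕ ⊝ withPrefix [] j (3 + p))
  ∎
  where
  open SetoidReasoning (ℕ →-setoid ℤ)
  ab = p ∷ suc p ∷ []

withPrefix-a : ∀ p k → withPrefix (p ∷ []) k p ≗
  q^ p · (q^ suc p · withPrefix [] (k - + 1 - + 1) (2 + p) ⊕ ⊝ withPrefix [] (k - + 1) (2 + p))
  ⊕ q^ suc p · (q^ suc p · (q^ (2 + p) · ⊝ withPrefix [] (k - + 1 - + 1 - + 1) (3 + p) ⊕ withPrefix [] (k - + 1 - + 1) (3 + p))
               ⊕ (q^ (2 + p) · withPrefix [] (k - + 1 - + 1) (3 + p) ⊕ ⊝ withPrefix [] (k - + 1) (3 + p)))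
withPrefix-a p k = begin
    withPrefix (p ∷ []) k p
  ≈⟨ withPrefix-split (p ∷ []) k p ⟩
    q^ p · withPrefix (p ∷ p ∷ []) (k - + 1) p ⊕ withPrefix (p ∷ []) k (suc p)
  ≈⟨ ⊕-cong (q^-cong p (withPrefix-aa p (k - + 1)))
            (λ m → trans (withPrefix-stop (p ∷ []) k (suc p) (weight-a p) m) (q^-cong (suc p) (withPrefix-ab p (k - + 1)) m)) ⟩
    q^ p · (q^ suc p · withPrefix [] (k - + 1 - + 1) (2 + p) ⊕ ⊝ withPrefix [] (k - + 1) (2 + p))
    ⊕ q^ suc p · (q^ suc p · (q^ (2 + p) · ⊝ withPrefix [] (k - + 1 - + 1 - + 1) (3 + p) ⊕ withPrefix [] (k - + 1 - + 1) (3 + p))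
                 ⊕ (q^ (2 + p) · withPrefix [] (k - + 1 - + 1) (3 + p) ⊕ ⊝ withPrefix [] (k - + 1) (3 + p)))
  ∎
  where open SetoidReasoning (ℕ →-setoid ℤ)

-- The recurrence

dropParts : ℕ → ℤ → ℤ
dropParts zero    i = i
dropParts (suc c) i = dropParts c (i - + 1)

dropParts≡- : ∀ c i → dropParts c i ≡ i - + c
dropParts≡- zero    i = sym (ℤ.+-identityʳ i)
dropParts≡- (suc c) i = trans (dropParts≡- c (i - + 1))
  (trans (ℤ.+-assoc i (ℤ.- + 1) (ℤ.- + c)) (cong (λ z → i ℤ.+ z) (sym (ℤ.neg-distrib-+ (+ 1) (+ c)))))

i-1≡+t⇒i≡+[1+t] : ∀ i t → i - + 1 ≡ + t → i ≡ + suc t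
i-1≡+t⇒i≡+[1+t] i t eq = begin
    i                    ≡⟨ sym (ℤ.+-identityʳ i) ⟩
    i ℤ.+ + 0            ≡⟨ sym (ℤ.+-assoc i (ℤ.- + 1) (+ 1)) ⟩
    i - + 1 ℤ.+ + 1      ≡⟨ cong (ℤ._+ + 1) eq ⟩
    + (t + 1)            ≡⟨ cong +_ (+-comm t 1) ⟩
    + suc t              ∎
  where open ≡-Reasoning

dropParts≡+t⇒i≡+[c+t] : ∀ c i t → dropParts c i ≡ + t → i ≡ + (c + t)
dropParts≡+t⇒i≡+[c+t] zero    i t eq = eq
dropParts≡+t⇒i≡+[c+t] (suc c) i t eq = i-1≡+t⇒i≡+[1+t] i (c + t) (dropParts≡+t⇒i≡+[c+t] c (i - + 1) t eq)

a+d*t≡d*[c+t]∸r : ∀ a d c r t → a + r ≡ d * c → a + d * t ≡ d * (c + t) ∸ r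
a+d*t≡d*[c+t]∸r a d c r t eq = sym (begin
    d * (c + t) ∸ r       ≡⟨ cong (_∸ r) (*-distribˡ-+ d c t) ⟩
    d * c + d * t ∸ r     ≡⟨ cong (λ x → x + d * t ∸ r) (sym eq) ⟩
    a + r + d * t ∸ r     ≡⟨ cong (_∸ r) (+-assoc a r (d * t)) ⟩
    a + (r + d * t) ∸ r   ≡⟨ cong (λ x → a + x ∸ r) (+-comm r (d * t)) ⟩
    a + (d * t + r) ∸ r   ≡⟨ cong (_∸ r) (sym (+-assoc a (d * t) r)) ⟩
    a + d * t + r ∸ r     ≡⟨ m+n∸n≡m (a + d * t) r ⟩
    a + d * t             ∎)
  where open ≡-Reasoning

q^-withPrefix≗q^-GF : ∀ a d j {b} → (∀ t → j ≡ + t → a + d * t ≡ b) → q^ a · withPrefix [] j (suc d) ≗ q^ b · GF j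
q^-withPrefix≗q^-GF a d (+ t) eq m =
  trans (q^-cong a (withPrefix≗q^GF d (+ t)) m) (trans (q^-q^ a (d * t) (GF (+ t)) m) (cong (λ e → (q^ e · GF (+ t)) m) (eq t refl)))
q^-withPrefix≗q^-GF a d -[1+ _ ] {b} eq m = trans (q^-0ˢ a m) (sym (q^-0ˢ b m))

q^-withPrefix≗q^-GF-dropParts : ∀ n c a d r → a + r ≡ d * c →
                       q^ a · withPrefix [] (dropParts c (+ n)) (suc d) ≗ q^ (d * n ∸ r) · GF (+ n - + c)
q^-withPrefix≗q^-GF-dropParts n c a d r eq m = trans
  (q^-withPrefix≗q^-GF a d (dropParts c (+ n))
     (λ t e → trans (a+d*t≡d*[c+t]∸r a d c r t eq)
                    (cong (λ k → d * k ∸ r) (sym (ℤ.+-injective (dropParts≡+t⇒i≡+[c+t] c (+ n) t e))))) m)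
  (cong (λ i → (q^ (d * n ∸ r) · GF i) m) (dropParts≡- c (+ n)))

x+y-y≡x : ∀ (x y : ℤ) → x ℤ.+ y ℤ.- y ≡ x
x+y-y≡x = solve-∀

GF-minus-shift : ∀ n → GF (+ n) ⊖ q^ n · GF (+ n) ≗ q^ 1 · withPrefix (1 ∷ []) (+ n - + 1) 1
GF-minus-shift n m = trans
  (cong₂ ℤ._-_ (trans (GF≗withPrefix (+ n) m) (withPrefix-split [] (+ n) 1 m))
               (trans (q^-cong n (GF≗withPrefix (+ n)) m) (sym (withPrefix-shift (+ n) 1 m))))
  (x+y-y≡x _ _)

withPrefix-1-expanded : ∀ k → q^ 1 · withPrefix (1 ∷ []) k 1 ≗
  (q^ 4 · withPrefix [] (k - + 1 - + 1) 3 ⊕ ⊝ (q^ 2 · withPrefix [] (k - + 1) 3))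
  ⊕ ((⊝ (q^ 8 · withPrefix [] (k - + 1 - + 1 - + 1) 4) ⊕ q^ 5 · withPrefix [] (k - + 1 - + 1) 4)
     ⊕ (q^ 6 · withPrefix [] (k - + 1 - + 1) 4 ⊕ ⊝ (q^ 3 · withPrefix [] (k - + 1) 4)))
withPrefix-1-expanded k = begin
    q^ 1 · withPrefix (1 ∷ []) k 1
  ≈⟨ q^-cong 1 (withPrefix-a 1 k) ⟩
    q^ 1 · (q^ 1 · X ⊕ q^ 2 · (q^ 2 · Y₁ ⊕ Y₂))
  ≈⟨ (λ m → trans (q^-⊕ 1 (q^ 1 · X) (q^ 2 · (q^ 2 · Y₁ ⊕ Y₂)) m)
                  (⊕-cong (q^-q^ 1 1 X) (q^-q^ 1 2 (q^ 2 · Y₁ ⊕ Y₂)) m)) ⟩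
    q^ 2 · (q^ 2 · A₂ ⊕ ⊝ A₁) ⊕ q^ 3 · (q^ 2 · Y₁ ⊕ (q^ 3 · B₂ ⊕ ⊝ B₁))
  ≈⟨ ⊕-cong (λ m → trans (q^-⊕ 2 (q^ 2 · A₂) (⊝ A₁) m) (⊕-cong (q^-q^ 2 2 A₂) (q^-⊝ 2 A₁) m))
            (λ m → trans (q^-⊕ 3 (q^ 2 · Y₁) Y₂ m) (⊕-cong (q^-q^ 3 2 Y₁) (q^-⊕ 3 (q^ 3 · B₂) (⊝ B₁)) m)) ⟩
    (q^ 4 · A₂ ⊕ ⊝ (q^ 2 · A₁)) ⊕ (q^ 5 · (q^ 3 · ⊝ B₃ ⊕ B₂) ⊕ (q^ 3 · q^ 3 · B₂ ⊕ q^ 3 · ⊝ B₁))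
  ≈⟨ ⊕-congʳ (q^ 4 · A₂ ⊕ ⊝ (q^ 2 · A₁))
       (⊕-cong (λ m → trans (q^-⊕ 5 (q^ 3 · ⊝ B₃) B₂ m)
                            (⊕-congˡ (q^ 5 · B₂) (λ m → trans (q^-q^ 5 3 (⊝ B₃) m) (q^-⊝ 8 B₃ m)) m))
               (⊕-cong (q^-q^ 3 3 B₂) (q^-⊝ 3 B₁))) ⟩
    (q^ 4 · A₂ ⊕ ⊝ (q^ 2 · A₁)) ⊕ ((⊝ (q^ 8 · B₃) ⊕ q^ 5 · B₂) ⊕ (q^ 6 · B₂ ⊕ ⊝ (q^ 3 · B₁)))
  ∎
  where
  open SetoidReasoning (ℕ →-setoid ℤ)
  A₁ = withPrefix [] (k - + 1) 3
  A₂ = withPrefix [] (k - + 1 - + 1) 3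
  B₁ = withPrefix [] (k - + 1) 4
  B₂ = withPrefix [] (k - + 1 - + 1) 4
  B₃ = withPrefix [] (k - + 1 - + 1 - + 1) 4
  X = q^ 2 · A₂ ⊕ ⊝ A₁
  Y₁ = q^ 3 · ⊝ B₃ ⊕ B₂
  Y₂ = q^ 3 · B₂ ⊕ ⊝ B₁

regroup : ∀ (T₁ T₂ T₃ T₄ T₅ T₆ : ℤ) →
  (T₃ ℤ.- T₁) ℤ.+ ((ℤ.- T₆ ℤ.+ T₄) ℤ.+ (T₅ ℤ.- T₂)) ≡ ((ℤ.- (T₁ ℤ.+ T₂)) ℤ.+ ((T₃ ℤ.+ T₄) ℤ.+ T₅)) ℤ.- T₆
regroup = solve-∀

proposition4p2 : (n : ℕ) → 1 ≤ n → (m : ℕ) →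
    (GF (+ n) ⊖ q^ n · GF (+ n)) m
      ≡ ((⊝ (q^ (2 * n ∸ 2) · GF (+ n - + 2) ⊕ q^ (3 * n ∸ 3) · GF (+ n - + 2)))
         ⊕ (q^ (2 * n ∸ 2) · GF (+ n - + 3) ⊕ q^ (3 * n ∸ 4) · GF (+ n - + 3) ⊕ q^ (3 * n ∸ 3) · GF (+ n - + 3))
         ⊖ q^ (3 * n ∸ 4) · GF (+ n - + 4)) m
proposition4p2 n _ m =
  trans (GF-minus-shift n m) (trans (withPrefix-1-expanded (+ n - + 1) m) (trans
    (cong₂ ℤ._+_ (cong₂ ℤ._-_ (term 3 4 2 2 refl) (term 2 2 2 2 refl))
                 (cong₂ ℤ._+_ (cong₂ ℤ._+_ (cong ℤ.-_ (term 4 8 3 4 refl)) (term 3 5 3 4 refl))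
                              (cong₂ ℤ._-_ (term 3 6 3 3 refl) (term 2 3 3 3 refl))))
    (regroup (coeff (2 * n ∸ 2) 2) (coeff (3 * n ∸ 3) 2) (coeff (2 * n ∸ 2) 3)
             (coeff (3 * n ∸ 4) 3) (coeff (3 * n ∸ 3) 3) (coeff (3 * n ∸ 4) 4))))
  where
  coeff : ℕ → ℕ → ℤ
  coeff e c = (q^ e · GF (+ n - + c)) m
  term : ∀ c a d r → a + r ≡ d * c →
         (q^ a · withPrefix [] (dropParts c (+ n)) (suc d)) m ≡ coeff (d * n ∸ r) c
  term c a d r eq = q^-withPrefix≗q^-GF-dropParts n c a d r eq m
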